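{- Let $n\ge1$ and let $t,u,x_1,\dots,x_n$ be indeterminates. For $1\le i\le n$ let $T_i$ be the operator on rational functions sending $x_i$ to $1/x_i$ (all other variables, including $u$, fixed). Then $$(1+T_1)\cdots(1+T_n)\left(\prod_{i=1}^n\frac{1-tx_i^2}{1-x_i^2}\,\frac{1-tu/x_i}{1-u/x_i}\prod_{1\le i<j\le n}\frac{1-tx_ix_j}{1-x_ix_j}\right)=\prod_{i=1}^{n-1}(t^i+1)\left(t^n+\prod_{i=1}^n\frac{1-tux_i}{1-ux_i}\,\frac{1-tu/x_i}{1-u/x_i}\right).$$ -}

module Defs where

open import Data.Nat using (ℕ; zero; suc)
open import Data.Fin using (Fin; _<_)
open import Data.Fin.Properties using (_<?_)
open import Data.Rational using (ℚ; 0ℚ; 1ℚ; _+_; _*_; _-_; 1/_; ≢-nonZero)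
open import Data.Rational.Properties using (_≟_)
open import Data.Vec.Functional using (Vector; updateAt; foldr)
open import Data.List using (List; allFin)
import Data.List as L
open import Relation.Nullary using (yes; no)
open import Function using (_∘_; id)

-- Total division on ℚ (convention: q / 0 = 0).  It is only ever used
-- under hypotheses guaranteeing that every denominator is nonzero.
inv : ℚ → ℚ
inv q with q ≟ 0ℚ
... | yes _ = 0ℚ
... | no q≢0 = 1/_ q {{≢-nonZero q≢0}}

_÷_ : ℚ → ℚ → ℚ
p ÷ q = p * inv q
infixl 7 _÷_

_^_ : ℚ → ℕ → ℚ
q ^ zero = 1ℚ
q ^ suc k = q * (q ^ k)
infixr 8 _^_

∏ : ∀ {n} → (Fin n → ℚ) → ℚ
∏ f = foldr _*_ 1ℚ f

∏[1‥_] : ℕ → (ℕ → ℚ) → ℚ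
∏[1‥ zero ] f = 1ℚ
∏[1‥ suc m ] f = ∏[1‥ m ] f * f (suc m)

∏< : ∀ {n} → (Fin n → Fin n → ℚ) → ℚ
∏< f = ∏ λ i → ∏ λ j → g i j
  where
  g : _ → _ → ℚ
  g i j with i <? j
  ... | yes _ = f i j
  ... | no _  = 1ℚ

Fun : ℕ → Set
Fun n = Vector ℚ n → ℚ

T : ∀ {n} → Fin n → Fun n → Fun n
T i f x = f (updateAt x i inv)

1+T : ∀ {n} → Fin n → Fun n → Fun n
1+T i f x = f x + T i f x

symOp : ∀ {n} → Fun n → Fun n
symOp {n} = L.foldr (λ i op → 1+T i ∘ op) id (allFin n)

F : ∀ {n} → ℚ → ℚ → Fun n
F t u x =
  ∏ (λ i → ((1ℚ - t * (x i * x i)) ÷ (1ℚ - x i * x i))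
         * ((1ℚ - t * u ÷ x i) ÷ (1ℚ - u ÷ x i)))
  * ∏< (λ i j → (1ℚ - t * (x i * x j)) ÷ (1ℚ - x i * x j))

RHS : ∀ {n} → ℚ → ℚ → Fun n
RHS {n} t u x =
  ∏[1‥ n Data.Nat.∸ 1 ] (λ i → t ^ i + 1ℚ)
  * (t ^ n + ∏ (λ i → ((1ℚ - t * u * x i) ÷ (1ℚ - u * x i))
                    * ((1ℚ - t * u ÷ x i) ÷ (1ℚ - u ÷ x i))))

-- Write c(z) = (1 - tz)/(1 - z).  The symmetrised function is Φ(x) ∏ᵢ c(u/xᵢ) with
-- Φ(x) = ∏ᵢ c(xᵢ²) ∏_{i<j} c(xᵢxⱼ), and (1+T₁)⋯(1+Tₙ) sums it over the 2ⁿ ways of inverting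
-- some of the xᵢ.  Everything rests on the partial fraction expansion in w
--   ∏_{z∈Z} c(wz) = t^|Z| + (1-t) Σ_{y∈Z} ∏_{z∈Z∖y} c(z/y) / (1 - wy)
-- for distinct nonzero z.  Expanding Φ(x,…) + Φ(1/x,…) with it (at w = x, 1/x and 0) gives
-- (1 + tⁿ) Φ(…) plus terms that are antisymmetric under y ↦ 1/y, so by induction the
-- symmetrisation of Φ alone is Macdonald's ∏ᵢ (1 + tⁱ).  Expanding ∏ c(u/xᵢ) at the points 1/xᵢ
-- reduces the left-hand side to this case plus a sum of residues, and expanding the right-hand
-- side ∏ c(uxᵢ) c(u/xᵢ) at the 2n points xᵢ^{±1} produces the same residues.

{-# OPTIONS --safe #-}
module Submission where

open import Defs
open import Level using (0ℓ)
open import Function using (_∘_; _∘′_; id)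
open import Data.Nat as ℕ using (ℕ; zero; suc; NonZero)
import Data.Nat.Properties as ℕ
open import Data.Fin using (Fin; zero; suc)
open import Data.Fin.Properties using (_<?_)
open import Data.Rational using (ℚ; 0ℚ; 1ℚ; _+_; _*_; _-_; ≢-nonZero)
open import Data.Rational.Properties
  using ( +-*-commutativeRing; +-0-group; +-0-commutativeMonoid; *-1-commutativeMonoid; _≟_
        ; +-comm; +-identityʳ; +-inverseʳ; *-assoc; *-comm; *-identityˡ; *-identityʳ; *-zeroˡ; *-zeroʳ
        ; *-inverseˡ; *-distribˡ-+; *-distribʳ-+ )
open import Data.List as List using (List; []; _∷_; map; length)
open import Data.List.Properties using (length-map; length-tabulate)
open import Data.List.Relation.Unary.All as All using (All; []; _∷_)
import Data.List.Relation.Unary.All.Properties as Allₚ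
open import Data.List.Relation.Unary.AllPairs as AllPairs using (AllPairs; []; _∷_)
import Data.List.Relation.Unary.AllPairs.Properties as AllPairsₚ
open import Data.List.Relation.Binary.Pointwise using (Pointwise; []; _∷_; Pointwise-length)
open import Data.Vec.Functional using (Vector; toList; tail; updateAt)
open import Data.Sum using (_⊎_; inj₁; inj₂)
open import Data.Product using (_×_; _,_; proj₁; proj₂)
open import Algebra.Bundles using (CommutativeMonoid)
open import Algebra.Properties.Group +-0-group using (x∙y⁻¹≈ε⇒x≈y)
open import Algebra.Properties.CommutativeSemigroup (CommutativeMonoid.commutativeSemigroup +-0-commutativeMonoid)
  using () renaming (interchange to +-interchange)
open import Algebra.Properties.CommutativeSemigroup (CommutativeMonoid.commutativeSemigroup *-1-commutativeMonoid)
  using () renaming (interchange to *-interchange; x∙yz≈y∙xz to x*[y*z]≡y*[x*z])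
open import Relation.Binary.Definitions using (Symmetric)
open import Relation.Binary.PropositionalEquality using (_≡_; _≢_; refl; sym; trans; cong; cong₂; module ≡-Reasoning)
open import Relation.Nullary using (yes; no; contradiction)
open import Relation.Nullary.Decidable using (dec⇒maybe)
open import Tactic.RingSolver using (solve-∀)
open import Tactic.RingSolver.Core.AlmostCommutativeRing using (AlmostCommutativeRing; fromCommutativeRing)

private
  variable
    A B : Set
    f g : A → ℚ
    K K′ : A → List A → ℚ
    p q a w x y z : ℚ

ℚ-ring : AlmostCommutativeRing 0ℓ 0ℓ
ℚ-ring = fromCommutativeRing +-*-commutativeRing (λ q → dec⇒maybe (0ℚ ≟ q))

-≡0⇒≡ : p - q ≡ 0ℚ → p ≡ q
-≡0⇒≡ {p} {q} = x∙y⁻¹≈ε⇒x≈y p q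

≢⇒-≢0 : p ≢ q → p - q ≢ 0ℚ
≢⇒-≢0 p≢q = p≢q ∘′ -≡0⇒≡

≢1⇒1-≢0 : p ≢ 1ℚ → 1ℚ - p ≢ 0ℚ
≢1⇒1-≢0 p≢1 = p≢1 ∘′ sym ∘′ -≡0⇒≡

-≢0⇒≢ : p - q ≢ 0ℚ → p ≢ q
-≢0⇒≢ {p} {q} p-q≢0 refl = p-q≢0 (+-inverseʳ p)

1-≢0⇒≢1 : 1ℚ - p ≢ 0ℚ → p ≢ 1ℚ
1-≢0⇒≢1 1-p≢0 refl = 1-p≢0 (+-inverseʳ 1ℚ)

inv-inverseˡ : q ≢ 0ℚ → inv q * q ≡ 1ℚ
inv-inverseˡ {q} q≢0 with q ≟ 0ℚ
... | yes q≡0 = contradiction q≡0 q≢0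
... | no q≢0′ = *-inverseˡ q {{≢-nonZero q≢0′}}

inv-inverseʳ : q ≢ 0ℚ → q * inv q ≡ 1ℚ
inv-inverseʳ {q} q≢0 = trans (*-comm q (inv q)) (inv-inverseˡ q≢0)

*-≢0 : p ≢ 0ℚ → q ≢ 0ℚ → p * q ≢ 0ℚ
*-≢0 {p} {q} p≢0 q≢0 pq≡0 = q≢0 (begin
  q                ≡⟨ sym (*-identityˡ q) ⟩
  1ℚ * q           ≡⟨ cong (_* q) (inv-inverseˡ p≢0) ⟨
  inv p * p * q    ≡⟨ *-assoc (inv p) p q ⟩
  inv p * (p * q)  ≡⟨ cong (inv p *_) pq≡0 ⟩
  inv p * 0ℚ       ≡⟨ *-zeroʳ (inv p) ⟩
  0ℚ               ∎)
  where open ≡-Reasoning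

inv-≢0 : q ≢ 0ℚ → inv q ≢ 0ℚ
inv-≢0 {q} q≢0 iq≡0 = contradiction (trans (sym (inv-inverseˡ q≢0)) (trans (cong (_* q) iq≡0) (*-zeroˡ q))) λ ()

inv-unique : p * q ≡ 1ℚ → inv p ≡ q
inv-unique {p} {q} pq≡1 = begin
  inv p              ≡⟨ *-identityʳ (inv p) ⟨
  inv p * 1ℚ         ≡⟨ cong (inv p *_) pq≡1 ⟨
  inv p * (p * q)    ≡⟨ *-assoc (inv p) p q ⟨
  inv p * p * q      ≡⟨ cong (_* q) (inv-inverseˡ p≢0) ⟩
  1ℚ * q             ≡⟨ *-identityˡ q ⟩
  q                  ∎
  where
  open ≡-Reasoning
  p≢0 : p ≢ 0ℚ
  p≢0 refl = contradiction (trans (sym (*-zeroˡ q)) pq≡1) λ ()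

-- Since inv 0ℚ = 0ℚ, inversion is an involutive multiplicative map on all of ℚ.
inv-involutive : ∀ q → inv (inv q) ≡ q
inv-involutive q with 0ℚ ≟ q
... | yes refl = refl
... | no 0≢q = inv-unique {inv q} {q} (inv-inverseˡ (0≢q ∘′ sym))

inv-injective : inv p ≡ inv q → p ≡ q
inv-injective {p} {q} e = trans (sym (inv-involutive p)) (trans (cong inv e) (inv-involutive q))

inv-distrib-* : ∀ p q → inv (p * q) ≡ inv p * inv q
inv-distrib-* p q with 0ℚ ≟ p | 0ℚ ≟ q
... | yes refl | _ = trans (cong inv (*-zeroˡ q)) (sym (*-zeroˡ (inv q)))
... | no _ | yes refl = trans (cong inv (*-zeroʳ p)) (sym (*-zeroʳ (inv p)))
... | no 0≢p | no 0≢q = inv-unique {p * q} {inv p * inv q} (begin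
  p * q * (inv p * inv q)      ≡⟨ regroup p q (inv p) (inv q) ⟩
  (p * inv p) * (q * inv q)    ≡⟨ cong₂ _*_ (inv-inverseʳ (0≢p ∘′ sym)) (inv-inverseʳ (0≢q ∘′ sym)) ⟩
  1ℚ                           ∎)
  where
  open ≡-Reasoning
  regroup : ∀ p q ip iq → p * q * (ip * iq) ≡ (p * ip) * (q * iq)
  regroup = solve-∀ ℚ-ring

inv*≡1⇒≡ : inv a * z ≡ 1ℚ → z ≡ a
inv*≡1⇒≡ {a} {z} e = trans (sym (inv-unique {inv a} {z} e)) (inv-involutive a)

inv≡⇒*≡1 : a ≢ 0ℚ → inv a ≡ z → a * z ≡ 1ℚ
inv≡⇒*≡1 {a} a≢0 refl = inv-inverseʳ a≢0

p*q÷q≡p : ∀ p {q} → q ≢ 0ℚ → p * q ÷ q ≡ p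
p*q÷q≡p p {q} q≢0 = begin
  p * q * inv q      ≡⟨ *-assoc p q (inv q) ⟩
  p * (q * inv q)    ≡⟨ cong (p *_) (inv-inverseʳ q≢0) ⟩
  p * 1ℚ             ≡⟨ *-identityʳ p ⟩
  p                  ∎
  where open ≡-Reasoning

[p÷q]*[r÷s]≡[p*r]÷[q*s] : ∀ p q r s → (p ÷ q) * (r ÷ s) ≡ (p * r) ÷ (q * s)
[p÷q]*[r÷s]≡[p*r]÷[q*s] p q r s = begin
  p * inv q * (r * inv s)     ≡⟨ regroup p r (inv q) (inv s) ⟩
  p * r * (inv q * inv s)     ≡⟨ cong (p * r *_) (inv-distrib-* q s) ⟨
  p * r * inv (q * s)         ∎
  where
  open ≡-Reasoning
  regroup : ∀ p r iq is → p * iq * (r * is) ≡ p * r * (iq * is)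
  regroup = solve-∀ ℚ-ring

[p÷q]÷[r÷s]≡[p*s]÷[q*r] : ∀ p q r s → (p ÷ q) ÷ (r ÷ s) ≡ (p * s) ÷ (q * r)
[p÷q]÷[r÷s]≡[p*s]÷[q*r] p q r s = begin
  p * inv q * inv (r * inv s)           ≡⟨ cong (p * inv q *_) (inv-distrib-* r (inv s)) ⟩
  p * inv q * (inv r * inv (inv s))     ≡⟨ cong (λ s′ → p * inv q * (inv r * s′)) (inv-involutive s) ⟩
  p * inv q * (inv r * s)               ≡⟨ regroup p s (inv q) (inv r) ⟩
  p * s * (inv q * inv r)               ≡⟨ cong (p * s *_) (inv-distrib-* q r) ⟨
  p * s * inv (q * r)                   ∎
  where
  open ≡-Reasoning
  regroup : ∀ p s iq ir → p * iq * (ir * s) ≡ p * s * (iq * ir)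
  regroup = solve-∀ ℚ-ring

p÷q+r÷s≡[p*s+r*q]÷[q*s] : ∀ p r {q s} → q ≢ 0ℚ → s ≢ 0ℚ → p ÷ q + r ÷ s ≡ (p * s + r * q) ÷ (q * s)
p÷q+r÷s≡[p*s+r*q]÷[q*s] p r {q} {s} q≢0 s≢0 = begin
  p * inv q + r * inv s                                ≡⟨ regroup₁ (p * inv q) (r * inv s) ⟩
  p * inv q * 1ℚ + r * inv s * 1ℚ                      ≡⟨ cong₂ (λ e e′ → p * inv q * e + r * inv s * e′)
                                                           (inv-inverseʳ s≢0) (inv-inverseʳ q≢0) ⟨
  p * inv q * (s * inv s) + r * inv s * (q * inv q)    ≡⟨ regroup₂ p q r s (inv q) (inv s) ⟩
  (p * s + r * q) * (inv q * inv s)                    ≡⟨ cong ((p * s + r * q) *_) (inv-distrib-* q s) ⟨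
  (p * s + r * q) * inv (q * s)                        ∎
  where
  open ≡-Reasoning
  regroup₁ : ∀ x y → x + y ≡ x * 1ℚ + y * 1ℚ
  regroup₁ = solve-∀ ℚ-ring
  regroup₂ : ∀ p q r s iq is → p * iq * (s * is) + r * is * (q * iq) ≡ (p * s + r * q) * (iq * is)
  regroup₂ = solve-∀ ℚ-ring

*≡*⇒÷≡÷ : ∀ p r {q s} → q ≢ 0ℚ → s ≢ 0ℚ → p * s ≡ r * q → p ÷ q ≡ r ÷ s
*≡*⇒÷≡÷ p r {q} {s} q≢0 s≢0 ps≡rq = begin
  p ÷ q                  ≡⟨ p*q÷q≡p (p ÷ q) s≢0 ⟨
  p ÷ q * s ÷ s          ≡⟨ cong (_÷ s) (regroup p (inv q) s) ⟩
  p * s ÷ q ÷ s          ≡⟨ cong (λ e → e ÷ q ÷ s) ps≡rq ⟩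
  r * q ÷ q ÷ s          ≡⟨ cong (_÷ s) (p*q÷q≡p r q≢0) ⟩
  r ÷ s                  ∎
  where
  open ≡-Reasoning
  regroup : ∀ p iq s → p * iq * s ≡ p * s * iq
  regroup = solve-∀ ℚ-ring

inv-≢1 : q ≢ 1ℚ → inv q ≢ 1ℚ
inv-≢1 {q} q≢1 iq≡1 = q≢1 (trans (sym (inv-involutive q)) (cong inv iq≡1))

inv≡1÷ : ∀ q → inv q ≡ 1ℚ ÷ q
inv≡1÷ q = sym (*-identityˡ (inv q))

inv-÷ : ∀ p q → inv (p ÷ q) ≡ q ÷ p
inv-÷ p q = begin
  inv (p * inv q)          ≡⟨ inv-distrib-* p (inv q) ⟩
  inv p * inv (inv q)      ≡⟨ cong (inv p *_) (inv-involutive q) ⟩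
  inv p * q                ≡⟨ *-comm (inv p) q ⟩
  q * inv p                ∎
  where open ≡-Reasoning

[p÷q]÷r≡p÷[q*r] : ∀ p q r → (p ÷ q) ÷ r ≡ p ÷ (q * r)
[p÷q]÷r≡p÷[q*r] p q r = trans (*-assoc p (inv q) (inv r)) (cong (p *_) (sym (inv-distrib-* q r)))

[p÷k]÷[q÷k]≡p÷q : ∀ {k} p q → k ≢ 0ℚ → (p ÷ k) ÷ (q ÷ k) ≡ p ÷ q
[p÷k]÷[q÷k]≡p÷q {k} p q k≢0 = begin
  p * inv k * inv (q * inv k)     ≡⟨ cong (p * inv k *_) (inv-÷ q k) ⟩
  p * inv k * (k * inv q)         ≡⟨ regroup p (inv k) k (inv q) ⟩
  p * inv q * (k * inv k)         ≡⟨ cong (p * inv q *_) (inv-inverseʳ k≢0) ⟩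
  p * inv q * 1ℚ                  ≡⟨ *-identityʳ (p * inv q) ⟩
  p * inv q                       ∎
  where
  open ≡-Reasoning
  regroup : ∀ p ik k iq → p * ik * (k * iq) ≡ p * iq * (k * ik)
  regroup = solve-∀ ℚ-ring

r-p÷q≡[r*q-p]÷q : ∀ r p {q} → q ≢ 0ℚ → r - p ÷ q ≡ (r * q - p) ÷ q
r-p÷q≡[r*q-p]÷q r p {q} q≢0 = begin
  r - p * inv q                  ≡⟨ cong (_- p * inv q) (*-identityʳ r) ⟨
  r * 1ℚ - p * inv q             ≡⟨ cong (λ e → r * e - p * inv q) (inv-inverseʳ q≢0) ⟨
  r * (q * inv q) - p * inv q    ≡⟨ regroup r q p (inv q) ⟩
  (r * q - p) * inv q            ∎
  where
  open ≡-Reasoning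
  regroup : ∀ r q p iq → r * (q * iq) - p * iq ≡ (r * q - p) * iq
  regroup = solve-∀ ℚ-ring

r+p÷q≡[r*q+p]÷q : ∀ r p {q} → q ≢ 0ℚ → r + p ÷ q ≡ (r * q + p) ÷ q
r+p÷q≡[r*q+p]÷q r p {q} q≢0 = begin
  r + p * inv q                  ≡⟨ cong (_+ p * inv q) (*-identityʳ r) ⟨
  r * 1ℚ + p * inv q             ≡⟨ cong (λ e → r * e + p * inv q) (inv-inverseʳ q≢0) ⟨
  r * (q * inv q) + p * inv q    ≡⟨ regroup r q p (inv q) ⟩
  (r * q + p) * inv q            ∎
  where
  open ≡-Reasoning
  regroup : ∀ r q p iq → r * (q * iq) + p * iq ≡ (r * q + p) * iq
  regroup = solve-∀ ℚ-ring

1-p÷q≡[q-p]÷q : ∀ p {q} → q ≢ 0ℚ → 1ℚ - p ÷ q ≡ (q - p) ÷ q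
1-p÷q≡[q-p]÷q p {q} q≢0 = trans (r-p÷q≡[r*q-p]÷q 1ℚ p q≢0) (cong (λ e → (e - p) ÷ q) (*-identityˡ q))

^-distribˡ-+-* : ∀ q m n → q ^ (m ℕ.+ n) ≡ q ^ m * q ^ n
^-distribˡ-+-* q ℕ.zero    n = sym (*-identityˡ (q ^ n))
^-distribˡ-+-* q (ℕ.suc m) n = trans (cong (q *_) (^-distribˡ-+-* q m n)) (sym (*-assoc q (q ^ m) (q ^ n)))

prod : (A → ℚ) → List A → ℚ
prod f []       = 1ℚ
prod f (a ∷ as) = f a * prod f as

prod-cong : (∀ z → f z ≡ g z) → ∀ L → prod f L ≡ prod g L
prod-cong f≗g []       = refl
prod-cong f≗g (a ∷ as) = cong₂ _*_ (f≗g a) (prod-cong f≗g as)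

prod-* : ∀ L → prod (λ z → f z * g z) L ≡ prod f L * prod g L
prod-* [] = refl
prod-* {f = f} {g = g} (a ∷ as) =
  trans (cong (f a * g a *_) (prod-* as)) (*-interchange (f a) (g a) (prod f as) (prod g as))

prod-≡1 : (∀ z → f z ≡ 1ℚ) → ∀ L → prod f L ≡ 1ℚ
prod-≡1 f≡1 []       = refl
prod-≡1 f≡1 (a ∷ as) = trans (cong₂ _*_ (f≡1 a) (prod-≡1 f≡1 as)) (*-identityˡ 1ℚ)

prod-map : (h : B → A) (L : List B) → prod f (map h L) ≡ prod (λ z → f (h z)) L
prod-map h []       = refl
prod-map {f = f} h (b ∷ bs) = cong (f (h b) *_) (prod-map h bs)

data Pick {A : Set} : List A → A → List A → Set where
  here  : ∀ {a as} → Pick (a ∷ as) a as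
  there : ∀ {a as y r} → Pick as y r → Pick (a ∷ as) y (a ∷ r)

Pick-length : ∀ {L : List A} {y r} → Pick L y r → length L ≡ suc (length r)
Pick-length here      = refl
Pick-length (there p) = cong suc (Pick-length p)

prod-pick : ∀ {L : List A} {y r} → Pick L y r → prod f L ≡ f y * prod f r
prod-pick here = refl
prod-pick {f = f} {L = a ∷ _} {y = y} {r = _ ∷ r} (there p) =
  trans (cong (f a *_) (prod-pick p)) (x*[y*z]≡y*[x*z] (f a) (f y) (prod f r))

All-pick : ∀ {P : A → Set} {L y r} → Pick L y r → All P L → All P (y ∷ r)
All-pick here      ps        = ps
All-pick (there p) (pa ∷ ps) with All-pick p ps
... | py ∷ pr = py ∷ pa ∷ pr

AllPairs-pick : ∀ {R : A → A → Set} {L y r} → Symmetric R → Pick L y r → AllPairs R L → AllPairs R (y ∷ r)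
AllPairs-pick R-sym here      rs        = rs
AllPairs-pick R-sym (there p) (ra ∷ rs) with All-pick p ra | AllPairs-pick R-sym p rs
... | ray ∷ rar | ryr ∷ rr = (R-sym ray ∷ ryr) ∷ rar ∷ rr

∑picks : (A → List A → ℚ) → List A → ℚ
∑picks K []       = 0ℚ
∑picks K (a ∷ as) = K a as + ∑picks (λ y r → K y (a ∷ r)) as

∑picks-cong : ∀ L → (∀ {y r} → Pick L y r → K y r ≡ K′ y r) → ∑picks K L ≡ ∑picks K′ L
∑picks-cong []       K≗K′ = refl
∑picks-cong (a ∷ as) K≗K′ = cong₂ _+_ (K≗K′ here) (∑picks-cong as (K≗K′ ∘ there))

∑picks-+ : ∀ L → ∑picks (λ y r → K y r + K′ y r) L ≡ ∑picks K L + ∑picks K′ L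
∑picks-+ [] = refl
∑picks-+ {K = K} {K′ = K′} (a ∷ as) =
  trans (cong (K a as + K′ a as +_) (∑picks-+ as))
        (+-interchange (K a as) (K′ a as) (∑picks (λ y r → K y (a ∷ r)) as)
                       (∑picks (λ y r → K′ y (a ∷ r)) as))

∑picks-*ˡ : ∀ k L → ∑picks (λ y r → k * K y r) L ≡ k * ∑picks K L
∑picks-*ˡ k [] = sym (*-zeroʳ k)
∑picks-*ˡ {K = K} k (a ∷ as) =
  trans (cong (k * K a as +_) (∑picks-*ˡ k as))
        (sym (*-distribˡ-+ k (K a as) (∑picks (λ y r → K y (a ∷ r)) as)))

∑picks-≡0 : ∀ L → (∀ {y r} → Pick L y r → K y r ≡ 0ℚ) → ∑picks K L ≡ 0ℚ
∑picks-≡0 []       K≡0 = refl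
∑picks-≡0 (a ∷ as) K≡0 = trans (cong₂ _+_ (K≡0 here) (∑picks-≡0 as (K≡0 ∘ there))) (+-identityʳ 0ℚ)

∑picks-map : (h : B → A) (L : List B) → ∑picks K (map h L) ≡ ∑picks (λ y r → K (h y) (map h r)) L
∑picks-map h []       = refl
∑picks-map {K = K} h (b ∷ bs) = cong (K (h b) (map h bs) +_) (∑picks-map h bs)

module Flips (σ : A → A) where

  ∑flips : (List A → ℚ) → List A → ℚ
  ∑flips G []       = G []
  ∑flips G (a ∷ as) = ∑flips (λ ys → G (a ∷ ys)) as + ∑flips (λ ys → G (σ a ∷ ys)) as

  Flip : List A → List A → Set
  Flip = Pointwise (λ a b → b ≡ a ⊎ b ≡ σ a)

  ∑flips-cong : ∀ {G G′ : List A → ℚ} xs → (∀ {ys} → Flip xs ys → G ys ≡ G′ ys) →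
                ∑flips G xs ≡ ∑flips G′ xs
  ∑flips-cong []       G≗G′ = G≗G′ []
  ∑flips-cong (a ∷ as) G≗G′ =
    cong₂ _+_ (∑flips-cong as (G≗G′ ∘ (inj₁ refl ∷_))) (∑flips-cong as (G≗G′ ∘ (inj₂ refl ∷_)))

  ∑flips-+ : ∀ (G G′ : List A → ℚ) xs → ∑flips (λ ys → G ys + G′ ys) xs ≡ ∑flips G xs + ∑flips G′ xs
  ∑flips-+ G G′ []       = refl
  ∑flips-+ G G′ (a ∷ as) =
    trans (cong₂ _+_ (∑flips-+ (G ∘ (a ∷_)) (G′ ∘ (a ∷_)) as) (∑flips-+ (G ∘ (σ a ∷_)) (G′ ∘ (σ a ∷_)) as))
          (+-interchange (∑flips (G ∘ (a ∷_)) as) (∑flips (G′ ∘ (a ∷_)) as)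
                         (∑flips (G ∘ (σ a ∷_)) as) (∑flips (G′ ∘ (σ a ∷_)) as))

  ∑flips-*ˡ : ∀ k (G : List A → ℚ) xs → ∑flips (λ ys → k * G ys) xs ≡ k * ∑flips G xs
  ∑flips-*ˡ k G []       = refl
  ∑flips-*ˡ k G (a ∷ as) =
    trans (cong₂ _+_ (∑flips-*ˡ k (G ∘ (a ∷_)) as) (∑flips-*ˡ k (G ∘ (σ a ∷_)) as))
          (sym (*-distribˡ-+ k (∑flips (G ∘ (a ∷_)) as) (∑flips (G ∘ (σ a ∷_)) as)))

  ∑flips-≡0 : ∀ {G : List A → ℚ} xs → (∀ ys → G ys ≡ 0ℚ) → ∑flips G xs ≡ 0ℚ
  ∑flips-≡0 []       G≡0 = G≡0 []
  ∑flips-≡0 (a ∷ as) G≡0 =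
    trans (cong₂ _+_ (∑flips-≡0 as (G≡0 ∘ (a ∷_))) (∑flips-≡0 as (G≡0 ∘ (σ a ∷_)))) (+-identityʳ 0ℚ)

  ∑flips-prod : (∀ z → f (σ z) ≡ f z) → ∀ (G : List A → ℚ) xs →
                ∑flips (λ ys → prod f ys * G ys) xs ≡ prod f xs * ∑flips G xs
  ∑flips-prod f∘σ≗f G []       = refl
  ∑flips-prod {f = f} f∘σ≗f G (a ∷ as) = begin
    ∑flips (λ ys → f a * prod f ys * G (a ∷ ys)) as + ∑flips (λ ys → f (σ a) * prod f ys * G (σ a ∷ ys)) as
      ≡⟨ cong₂ _+_ (∑flips-cong as λ {ys} _ → *-assoc (f a) (prod f ys) (G (a ∷ ys)))
                   (∑flips-cong as λ {ys} _ → trans (cong (λ e → e * prod f ys * G (σ a ∷ ys)) (f∘σ≗f a))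
                                                    (*-assoc (f a) (prod f ys) (G (σ a ∷ ys)))) ⟩
    ∑flips (λ ys → f a * (prod f ys * G (a ∷ ys))) as + ∑flips (λ ys → f a * (prod f ys * G (σ a ∷ ys))) as
      ≡⟨ cong₂ _+_ (∑flips-*ˡ (f a) _ as) (∑flips-*ˡ (f a) _ as) ⟩
    f a * ∑flips (λ ys → prod f ys * G (a ∷ ys)) as + f a * ∑flips (λ ys → prod f ys * G (σ a ∷ ys)) as
      ≡⟨ cong₂ (λ e e′ → f a * e + f a * e′)
               (∑flips-prod f∘σ≗f (G ∘ (a ∷_)) as) (∑flips-prod f∘σ≗f (G ∘ (σ a ∷_)) as) ⟩
    f a * (prod f as * ∑flips (G ∘ (a ∷_)) as) + f a * (prod f as * ∑flips (G ∘ (σ a ∷_)) as)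
      ≡⟨ factor (f a) (prod f as) (∑flips (G ∘ (a ∷_)) as) (∑flips (G ∘ (σ a ∷_)) as) ⟩
    f a * prod f as * (∑flips (G ∘ (a ∷_)) as + ∑flips (G ∘ (σ a ∷_)) as)
      ∎
    where
    open ≡-Reasoning
    factor : ∀ x p g g′ → x * (p * g) + x * (p * g′) ≡ x * p * (g + g′)
    factor = solve-∀ ℚ-ring

  ∑flips-∑picks : ∀ (H : A → List A → ℚ) xs →
                  ∑flips (∑picks H) xs ≡ ∑picks (λ y r → ∑flips (λ rs → H y rs + H (σ y) rs) r) xs
  ∑flips-∑picks H []       = refl
  ∑flips-∑picks H (a ∷ as) = begin
    ∑flips (λ ys → H a ys + ∑picks (λ y r → H y (a ∷ r)) ys) as
      + ∑flips (λ ys → H (σ a) ys + ∑picks (λ y r → H y (σ a ∷ r)) ys) as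
      ≡⟨ cong₂ _+_ (∑flips-+ (H a) (∑picks (λ y r → H y (a ∷ r))) as)
                   (∑flips-+ (H (σ a)) (∑picks (λ y r → H y (σ a ∷ r))) as) ⟩
    (∑flips (H a) as + ∑flips (∑picks (λ y r → H y (a ∷ r))) as)
      + (∑flips (H (σ a)) as + ∑flips (∑picks (λ y r → H y (σ a ∷ r))) as)
      ≡⟨ +-interchange (∑flips (H a) as) (∑flips (∑picks (λ y r → H y (a ∷ r))) as)
                       (∑flips (H (σ a)) as) (∑flips (∑picks (λ y r → H y (σ a ∷ r))) as) ⟩
    (∑flips (H a) as + ∑flips (H (σ a)) as)
      + (∑flips (∑picks (λ y r → H y (a ∷ r))) as + ∑flips (∑picks (λ y r → H y (σ a ∷ r))) as)
      ≡⟨ cong₂ _+_ (sym (∑flips-+ (H a) (H (σ a)) as))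
                   (cong₂ _+_ (∑flips-∑picks (λ y r → H y (a ∷ r)) as)
                              (∑flips-∑picks (λ y r → H y (σ a ∷ r)) as)) ⟩
    ∑flips (λ rs → H a rs + H (σ a) rs) as
      + (∑picks (λ y r → ∑flips (λ rs → H y (a ∷ rs) + H (σ y) (a ∷ rs)) r) as
         + ∑picks (λ y r → ∑flips (λ rs → H y (σ a ∷ rs) + H (σ y) (σ a ∷ rs)) r) as)
      ≡⟨ cong (∑flips (λ rs → H a rs + H (σ a) rs) as +_) (sym (∑picks-+ as)) ⟩
    ∑flips (λ rs → H a rs + H (σ a) rs) as
      + ∑picks (λ y r → ∑flips (λ rs → H y rs + H (σ y) rs) (a ∷ r)) as
      ∎
    where
    open ≡-Reasoning

  All-flip : ∀ {P : A → Set} → (∀ {a} → P a → P (σ a)) → ∀ {xs ys} → Flip xs ys → All P xs → All P ys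
  All-flip P∘σ [] [] = []
  All-flip P∘σ (inj₁ refl ∷ f) (pa ∷ ps) = pa ∷ All-flip P∘σ f ps
  All-flip P∘σ (inj₂ refl ∷ f) (pa ∷ ps) = P∘σ pa ∷ All-flip P∘σ f ps

  AllPairs-flip : ∀ {R : A → A → Set} → (∀ {a z} → R a z → R (σ a) z) → (∀ {a z} → R a z → R a (σ z)) →
                  ∀ {xs ys} → Flip xs ys → AllPairs R xs → AllPairs R ys
  AllPairs-flip σR Rσ [] [] = []
  AllPairs-flip σR Rσ (inj₁ refl ∷ f) (ra ∷ rs) = All-flip Rσ f ra ∷ AllPairs-flip σR Rσ f rs
  AllPairs-flip σR Rσ (inj₂ refl ∷ f) (ra ∷ rs) = All-flip Rσ f (All.map σR ra) ∷ AllPairs-flip σR Rσ f rs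

  doubled : List A → List A
  doubled []       = []
  doubled (a ∷ as) = a ∷ σ a ∷ doubled as

  length-doubled : ∀ xs → length (doubled xs) ≡ length xs ℕ.+ length xs
  length-doubled []       = refl
  length-doubled (a ∷ as) = cong suc (trans (cong suc (length-doubled as)) (sym (ℕ.+-suc (length as) (length as))))

  prod-doubled : ∀ xs → prod f (doubled xs) ≡ prod (λ z → f z * f (σ z)) xs
  prod-doubled []       = refl
  prod-doubled {f = f} (a ∷ as) = trans (sym (*-assoc (f a) (f (σ a)) _)) (cong (f a * f (σ a) *_) (prod-doubled as))

  ∑picks-doubled : ∀ (ψ : A → A → ℚ) (E : A → ℚ) xs →
    ∑picks (λ y r → E y * prod (ψ y) r) (doubled xs)
    ≡ ∑picks (λ y r → E y * ψ y (σ y) * prod (λ z → ψ y z * ψ y (σ z)) r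
                    + E (σ y) * ψ (σ y) y * prod (λ z → ψ (σ y) z * ψ (σ y) (σ z)) r) xs
  ∑picks-doubled ψ E []       = refl
  ∑picks-doubled ψ E (a ∷ as) = begin
    E a * (ψ a (σ a) * prod (ψ a) (doubled as)) + (E (σ a) * (ψ (σ a) a * prod (ψ (σ a)) (doubled as)) + rest)
      ≡⟨ cong₂ (λ e e′ → E a * (ψ a (σ a) * e) + (E (σ a) * (ψ (σ a) a * e′) + rest))
               (prod-doubled as) (prod-doubled as) ⟩
    E a * (ψ a (σ a) * prod (ψ² a) as) + (E (σ a) * (ψ (σ a) a * prod (ψ² (σ a)) as) + rest)
      ≡⟨ reassoc (E a) (ψ a (σ a)) (prod (ψ² a) as) (E (σ a)) (ψ (σ a) a) (prod (ψ² (σ a)) as) rest ⟩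
    E a * ψ a (σ a) * prod (ψ² a) as + E (σ a) * ψ (σ a) a * prod (ψ² (σ a)) as + rest
      ≡⟨ cong (E a * ψ a (σ a) * prod (ψ² a) as + E (σ a) * ψ (σ a) a * prod (ψ² (σ a)) as +_) rest≡ ⟩
    E a * ψ a (σ a) * prod (ψ² a) as + E (σ a) * ψ (σ a) a * prod (ψ² (σ a)) as
      + ∑picks (λ y r → E y * ψ y (σ y) * prod (ψ² y) (a ∷ r)
                      + E (σ y) * ψ (σ y) y * prod (ψ² (σ y)) (a ∷ r)) as
      ∎
    where
    open ≡-Reasoning
    ψ² : A → A → ℚ
    ψ² y z = ψ y z * ψ y (σ z)
    reassoc : ∀ e p r e′ p′ r′ s → e * (p * r) + (e′ * (p′ * r′) + s) ≡ e * p * r + e′ * p′ * r′ + s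
    reassoc = solve-∀ ℚ-ring
    reassoc₁ : ∀ e p q r → e * (p * (q * r)) ≡ e * (p * q) * r
    reassoc₁ = solve-∀ ℚ-ring
    reassoc₂ : ∀ e p q r → e * p * q * r ≡ e * q * (p * r)
    reassoc₂ = solve-∀ ℚ-ring
    rest : ℚ
    rest = ∑picks (λ y r → E y * (ψ y a * (ψ y (σ a) * prod (ψ y) r))) (doubled as)
    rest≡ : rest ≡ ∑picks (λ y r → E y * ψ y (σ y) * prod (ψ² y) (a ∷ r)
                                 + E (σ y) * ψ (σ y) y * prod (ψ² (σ y)) (a ∷ r)) as
    rest≡ = begin
      rest
        ≡⟨ ∑picks-cong (doubled as) (λ {y} {r} _ → reassoc₁ (E y) (ψ y a) (ψ y (σ a)) (prod (ψ y) r)) ⟩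
      ∑picks (λ y r → E y * ψ² y a * prod (ψ y) r) (doubled as)
        ≡⟨ ∑picks-doubled ψ (λ y → E y * ψ² y a) as ⟩
      ∑picks (λ y r → E y * ψ² y a * ψ y (σ y) * prod (ψ² y) r
                    + E (σ y) * ψ² (σ y) a * ψ (σ y) y * prod (ψ² (σ y)) r) as
        ≡⟨ ∑picks-cong as (λ {y} {r} _ →
             cong₂ _+_ (reassoc₂ (E y) (ψ² y a) (ψ y (σ y)) (prod (ψ² y) r))
                       (reassoc₂ (E (σ y)) (ψ² (σ y) a) (ψ (σ y) y) (prod (ψ² (σ y)) r))) ⟩
      ∑picks (λ y r → E y * ψ y (σ y) * prod (ψ² y) (a ∷ r)
                    + E (σ y) * ψ (σ y) y * prod (ψ² (σ y)) (a ∷ r)) as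
        ∎

  All-doubled : ∀ {P : A → Set} {xs} → All (λ z → P z × P (σ z)) xs → All P (doubled xs)
  All-doubled []               = []
  All-doubled ((pa , pσa) ∷ ps) = pa ∷ pσa ∷ All-doubled ps

partial-fractions-two-poles : a ≢ 0ℚ → y ≢ 0ℚ → a ≢ y → w * a ≢ 1ℚ → w * y ≢ 1ℚ →
  inv (1ℚ - w * a) * inv (1ℚ - w * y)
  ≡ inv (1ℚ - a ÷ y) * inv (1ℚ - w * y) + inv (1ℚ - w * a) * inv (1ℚ - inv a * y)
partial-fractions-two-poles {a} {y} {w} a≢0 y≢0 a≢y wa≢1 wy≢1 = sym (begin
  inv (1ℚ - a ÷ y) * inv (1ℚ - w * y) + inv (1ℚ - w * a) * inv (1ℚ - inv a * y)
    ≡⟨ cong₂ (λ e e′ → inv e * inv (1ℚ - w * y) + inv (1ℚ - w * a) * inv e′)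
             (1-p÷q≡[q-p]÷q a y≢0)
             (trans (cong (1ℚ -_) (*-comm (inv a) y)) (1-p÷q≡[q-p]÷q y a≢0)) ⟩
  inv ((y - a) ÷ y) * inv (1ℚ - w * y) + inv (1ℚ - w * a) * inv ((a - y) ÷ a)
    ≡⟨ cong₂ (λ e e′ → e * inv (1ℚ - w * y) + inv (1ℚ - w * a) * e′) (inv-÷ (y - a) y) (inv-÷ (a - y) a) ⟩
  y ÷ (y - a) ÷ (1ℚ - w * y) + inv (1ℚ - w * a) * (a ÷ (a - y))
    ≡⟨ cong₂ _+_ ([p÷q]÷r≡p÷[q*r] y (y - a) (1ℚ - w * y))
                 (trans (*-comm (inv (1ℚ - w * a)) (a ÷ (a - y))) ([p÷q]÷r≡p÷[q*r] a (a - y) (1ℚ - w * a))) ⟩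
  y ÷ D₁ + a ÷ D₂
    ≡⟨ p÷q+r÷s≡[p*s+r*q]÷[q*s] y a D₁≢0 D₂≢0 ⟩
  (y * D₂ + a * D₁) ÷ (D₁ * D₂)
    ≡⟨ *≡*⇒÷≡÷ (y * D₂ + a * D₁) 1ℚ (*-≢0 D₁≢0 D₂≢0) (*-≢0 1-wa≢0 1-wy≢0) (cross a y w) ⟩
  1ℚ ÷ ((1ℚ - w * a) * (1ℚ - w * y))
    ≡⟨ *-identityˡ (inv ((1ℚ - w * a) * (1ℚ - w * y))) ⟩
  inv ((1ℚ - w * a) * (1ℚ - w * y))
    ≡⟨ inv-distrib-* (1ℚ - w * a) (1ℚ - w * y) ⟩
  inv (1ℚ - w * a) * inv (1ℚ - w * y) ∎)
  where
  open ≡-Reasoning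
  D₁ = (y - a) * (1ℚ - w * y)
  D₂ = (a - y) * (1ℚ - w * a)
  1-wa≢0 = ≢1⇒1-≢0 wa≢1
  1-wy≢0 = ≢1⇒1-≢0 wy≢1
  D₁≢0 = *-≢0 (≢⇒-≢0 (a≢y ∘′ sym)) 1-wy≢0
  D₂≢0 = *-≢0 (≢⇒-≢0 a≢y) 1-wa≢0
  cross : ∀ a y w → (y * ((a - y) * (1ℚ - w * a)) + a * ((y - a) * (1ℚ - w * y))) * ((1ℚ - w * a) * (1ℚ - w * y))
                    ≡ 1ℚ * ((y - a) * (1ℚ - w * y) * ((a - y) * (1ℚ - w * a)))
  cross = solve-∀ ℚ-ring

inv[1-z]+inv[1-inv[z]]≡1 : z ≢ 0ℚ → z ≢ 1ℚ → inv (1ℚ - z) + inv (1ℚ - inv z) ≡ 1ℚ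
inv[1-z]+inv[1-inv[z]]≡1 {z} z≢0 z≢1 = begin
  inv (1ℚ - z) + inv (1ℚ - inv z)
    ≡⟨ cong₂ (λ e e′ → e + inv (1ℚ - e′)) (inv≡1÷ (1ℚ - z)) (inv≡1÷ z) ⟩
  1ℚ ÷ (1ℚ - z) + inv (1ℚ - 1ℚ ÷ z)
    ≡⟨ cong (λ e → 1ℚ ÷ (1ℚ - z) + inv e) (1-p÷q≡[q-p]÷q 1ℚ z≢0) ⟩
  1ℚ ÷ (1ℚ - z) + inv ((z - 1ℚ) ÷ z)
    ≡⟨ cong (1ℚ ÷ (1ℚ - z) +_) (inv-÷ (z - 1ℚ) z) ⟩
  1ℚ ÷ (1ℚ - z) + z ÷ (z - 1ℚ)
    ≡⟨ p÷q+r÷s≡[p*s+r*q]÷[q*s] 1ℚ z 1-z≢0 z-1≢0 ⟩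
  (1ℚ * (z - 1ℚ) + z * (1ℚ - z)) ÷ ((1ℚ - z) * (z - 1ℚ))
    ≡⟨ cong (_÷ ((1ℚ - z) * (z - 1ℚ))) (numerator z) ⟩
  1ℚ * ((1ℚ - z) * (z - 1ℚ)) ÷ ((1ℚ - z) * (z - 1ℚ))
    ≡⟨ p*q÷q≡p 1ℚ (*-≢0 1-z≢0 z-1≢0) ⟩
  1ℚ ∎
  where
  open ≡-Reasoning
  1-z≢0 = ≢1⇒1-≢0 z≢1
  z-1≢0 = ≢⇒-≢0 z≢1
  numerator : ∀ z → 1ℚ * (z - 1ℚ) + z * (1ℚ - z) ≡ 1ℚ * ((1ℚ - z) * (z - 1ℚ))
  numerator = solve-∀ ℚ-ring

inv[x]*inv[x]≡1÷[x*x] : ∀ x → inv x * inv x ≡ 1ℚ ÷ (x * x)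
inv[x]*inv[x]≡1÷[x*x] x = trans (sym (inv-distrib-* x x)) (inv≡1÷ (x * x))

module Factor (t : ℚ) where

  c : ℚ → ℚ
  c z = (1ℚ - t * z) ÷ (1ℚ - z)

  b : ℚ → ℚ
  b x = c (x * x)

  c-partial-fraction : z ≢ 1ℚ → c z ≡ t + (1ℚ - t) ÷ (1ℚ - z)
  c-partial-fraction {z} z≢1 = begin
    (1ℚ - t * z) ÷ (1ℚ - z)
      ≡⟨ cong (_÷ (1ℚ - z)) (split t z) ⟩
    (t * (1ℚ - z) + (1ℚ - t)) ÷ (1ℚ - z)
      ≡⟨ *-distribʳ-+ (inv (1ℚ - z)) (t * (1ℚ - z)) (1ℚ - t) ⟩
    t * (1ℚ - z) ÷ (1ℚ - z) + (1ℚ - t) ÷ (1ℚ - z)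
      ≡⟨ cong (_+ (1ℚ - t) ÷ (1ℚ - z)) (p*q÷q≡p t (≢1⇒1-≢0 z≢1)) ⟩
    t + (1ℚ - t) ÷ (1ℚ - z) ∎
    where
    open ≡-Reasoning
    split : ∀ t z → 1ℚ - t * z ≡ t * (1ℚ - z) + (1ℚ - t)
    split = solve-∀ ℚ-ring

  c-0 : c 0ℚ ≡ 1ℚ
  c-0 = cong (λ e → (1ℚ - e) ÷ (1ℚ - 0ℚ)) (*-zeroʳ t)

  c-÷ : ∀ p {q} → q ≢ 0ℚ → c (p ÷ q) ≡ (q - t * p) ÷ (q - p)
  c-÷ p {q} q≢0 = begin
    (1ℚ - t * (p ÷ q)) ÷ (1ℚ - p ÷ q)
      ≡⟨ cong (λ e → (1ℚ - e) ÷ (1ℚ - p ÷ q)) (*-assoc t p (inv q)) ⟨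
    (1ℚ - t * p ÷ q) ÷ (1ℚ - p ÷ q)
      ≡⟨ cong₂ _÷_ (1-p÷q≡[q-p]÷q (t * p) q≢0) (1-p÷q≡[q-p]÷q p q≢0) ⟩
    ((q - t * p) ÷ q) ÷ ((q - p) ÷ q)
      ≡⟨ [p÷k]÷[q÷k]≡p÷q (q - t * p) (q - p) q≢0 ⟩
    (q - t * p) ÷ (q - p) ∎
    where open ≡-Reasoning

  b-inv : x ≢ 0ℚ → b (inv x) ≡ (x * x - t) ÷ (x * x - 1ℚ)
  b-inv {x} x≢0 = begin
    c (inv x * inv x)                    ≡⟨ cong c (inv[x]*inv[x]≡1÷[x*x] x) ⟩
    c (1ℚ ÷ (x * x))                     ≡⟨ c-÷ 1ℚ (*-≢0 x≢0 x≢0) ⟩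
    (x * x - t * 1ℚ) ÷ (x * x - 1ℚ)      ≡⟨ cong (λ e → (x * x - e) ÷ (x * x - 1ℚ)) (*-identityʳ t) ⟩
    (x * x - t) ÷ (x * x - 1ℚ)           ∎
    where open ≡-Reasoning

  b+b∘inv : x ≢ 0ℚ → x * x ≢ 1ℚ → b x + b (inv x) ≡ 1ℚ + t
  b+b∘inv {x} x≢0 xx≢1 = begin
    c (x * x) + c (inv x * inv x)
      ≡⟨ cong (λ e → c (x * x) + c e) (inv-distrib-* x x) ⟨
    c (x * x) + c (inv (x * x))
      ≡⟨ cong₂ _+_ (c-partial-fraction xx≢1) (c-partial-fraction (inv-≢1 xx≢1)) ⟩
    t + (1ℚ - t) ÷ (1ℚ - x * x) + (t + (1ℚ - t) ÷ (1ℚ - inv (x * x)))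
      ≡⟨ collect t (inv (1ℚ - x * x)) (inv (1ℚ - inv (x * x))) ⟩
    t + t + (1ℚ - t) * (inv (1ℚ - x * x) + inv (1ℚ - inv (x * x)))
      ≡⟨ cong (λ e → t + t + (1ℚ - t) * e) (inv[1-z]+inv[1-inv[z]]≡1 (*-≢0 x≢0 x≢0) xx≢1) ⟩
    t + t + (1ℚ - t) * 1ℚ
      ≡⟨ simplify t ⟩
    1ℚ + t ∎
    where
    open ≡-Reasoning
    collect : ∀ t p q → t + (1ℚ - t) * p + (t + (1ℚ - t) * q) ≡ t + t + (1ℚ - t) * (p + q)
    collect = solve-∀ ℚ-ring
    simplify : ∀ t → t + t + (1ℚ - t) * 1ℚ ≡ 1ℚ + t
    simplify = solve-∀ ℚ-ring

  h : ℚ → ℚ → ℚ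
  h x y = x * (t - y * y) ÷ ((1ℚ - x * y) * (x - y))

  b-poles : x ≢ 0ℚ → x * x ≢ 1ℚ → x * y ≢ 1ℚ → x ≢ y →
            b x ÷ (1ℚ - x * y) + b (inv x) ÷ (1ℚ - inv x * y) ≡ 1ℚ + h x y
  b-poles {x} {y} x≢0 xx≢1 xy≢1 x≢y = begin
    b x ÷ (1ℚ - x * y) + b (inv x) ÷ (1ℚ - inv x * y)
      ≡⟨ cong₂ (λ e e′ → b x ÷ (1ℚ - x * y) + e ÷ (1ℚ - e′)) (b-inv x≢0) (*-comm (inv x) y) ⟩
    b x ÷ (1ℚ - x * y) + ((x * x - t) ÷ (x * x - 1ℚ)) ÷ (1ℚ - y ÷ x)
      ≡⟨ cong (λ e → b x ÷ (1ℚ - x * y) + ((x * x - t) ÷ (x * x - 1ℚ)) ÷ e) (1-p÷q≡[q-p]÷q y x≢0) ⟩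
    ((1ℚ - t * (x * x)) ÷ (1ℚ - x * x)) ÷ (1ℚ - x * y) + ((x * x - t) ÷ (x * x - 1ℚ)) ÷ ((x - y) ÷ x)
      ≡⟨ cong₂ _+_ ([p÷q]÷r≡p÷[q*r] (1ℚ - t * (x * x)) (1ℚ - x * x) (1ℚ - x * y))
                   ([p÷q]÷[r÷s]≡[p*s]÷[q*r] (x * x - t) (x * x - 1ℚ) (x - y) x) ⟩
    N₁ ÷ D₁ + N₂ ÷ D₂
      ≡⟨ p÷q+r÷s≡[p*s+r*q]÷[q*s] N₁ N₂ D₁≢0 D₂≢0 ⟩
    (N₁ * D₂ + N₂ * D₁) ÷ (D₁ * D₂)
      ≡⟨ *≡*⇒÷≡÷ (N₁ * D₂ + N₂ * D₁) (1ℚ * D + x * (t - y * y)) (*-≢0 D₁≢0 D₂≢0) D≢0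
                 (cross t x y) ⟩
    (1ℚ * D + x * (t - y * y)) ÷ D
      ≡⟨ r+p÷q≡[r*q+p]÷q 1ℚ (x * (t - y * y)) D≢0 ⟨
    1ℚ + h x y ∎
    where
    open ≡-Reasoning
    N₁ = 1ℚ - t * (x * x)
    D₁ = (1ℚ - x * x) * (1ℚ - x * y)
    N₂ = (x * x - t) * x
    D₂ = (x * x - 1ℚ) * (x - y)
    D = (1ℚ - x * y) * (x - y)
    D₁≢0 = *-≢0 (≢1⇒1-≢0 xx≢1) (≢1⇒1-≢0 xy≢1)
    D₂≢0 = *-≢0 (≢⇒-≢0 xx≢1) (≢⇒-≢0 x≢y)
    D≢0 = *-≢0 (≢1⇒1-≢0 xy≢1) (≢⇒-≢0 x≢y)
    cross : ∀ t x y →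
      ((1ℚ - t * (x * x)) * ((x * x - 1ℚ) * (x - y)) + (x * x - t) * x * ((1ℚ - x * x) * (1ℚ - x * y)))
        * ((1ℚ - x * y) * (x - y))
      ≡ (1ℚ * ((1ℚ - x * y) * (x - y)) + x * (t - y * y))
        * ((1ℚ - x * x) * (1ℚ - x * y) * ((x * x - 1ℚ) * (x - y)))
    cross = solve-∀ ℚ-ring

  h-inv : y ≢ 0ℚ → h x (inv y) ≡ x * (t * (y * y) - 1ℚ) ÷ ((y - x) * (x * y - 1ℚ))
  h-inv {y} {x} y≢0 = begin
    x * (t - inv y * inv y) ÷ ((1ℚ - x ÷ y) * (x - inv y))
      ≡⟨ cong₂ (λ e e′ → x * (t - e) ÷ ((1ℚ - x ÷ y) * (x - e′))) (inv[x]*inv[x]≡1÷[x*x] y) (inv≡1÷ y) ⟩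
    x * (t - 1ℚ ÷ (y * y)) ÷ ((1ℚ - x ÷ y) * (x - 1ℚ ÷ y))
      ≡⟨ cong₂ (λ e e′ → x * e ÷ e′) (r-p÷q≡[r*q-p]÷q t 1ℚ yy≢0)
               (cong₂ _*_ (1-p÷q≡[q-p]÷q x y≢0) (r-p÷q≡[r*q-p]÷q x 1ℚ y≢0)) ⟩
    x * ((t * (y * y) - 1ℚ) ÷ (y * y)) ÷ (((y - x) ÷ y) * ((x * y - 1ℚ) ÷ y))
      ≡⟨ cong₂ _÷_ (sym (*-assoc x (t * (y * y) - 1ℚ) (inv (y * y))))
                   ([p÷q]*[r÷s]≡[p*r]÷[q*s] (y - x) y (x * y - 1ℚ) y) ⟩
    (x * (t * (y * y) - 1ℚ) ÷ (y * y)) ÷ (((y - x) * (x * y - 1ℚ)) ÷ (y * y))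
      ≡⟨ [p÷k]÷[q÷k]≡p÷q (x * (t * (y * y) - 1ℚ)) ((y - x) * (x * y - 1ℚ)) yy≢0 ⟩
    x * (t * (y * y) - 1ℚ) ÷ ((y - x) * (x * y - 1ℚ)) ∎
    where
    open ≡-Reasoning
    yy≢0 = *-≢0 y≢0 y≢0

  b*h-antisymmetric : y ≢ 0ℚ → y * y ≢ 1ℚ → x * y ≢ 1ℚ → x ≢ y →
                      b y * h x y + b (inv y) * h x (inv y) ≡ 0ℚ
  b*h-antisymmetric {y} {x} y≢0 yy≢1 xy≢1 x≢y = begin
    b y * h x y + b (inv y) * h x (inv y)
      ≡⟨ cong₂ (λ e e′ → b y * h x y + e * e′) (b-inv y≢0) (h-inv {x = x} y≢0) ⟩
    ((1ℚ - t * (y * y)) ÷ (1ℚ - y * y)) * (x * (t - y * y) ÷ ((1ℚ - x * y) * (x - y)))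
      + ((y * y - t) ÷ (y * y - 1ℚ)) * (x * (t * (y * y) - 1ℚ) ÷ ((y - x) * (x * y - 1ℚ)))
      ≡⟨ cong₂ _+_ ([p÷q]*[r÷s]≡[p*r]÷[q*s] (1ℚ - t * (y * y)) (1ℚ - y * y)
                                            (x * (t - y * y)) ((1ℚ - x * y) * (x - y)))
                   ([p÷q]*[r÷s]≡[p*r]÷[q*s] (y * y - t) (y * y - 1ℚ)
                                            (x * (t * (y * y) - 1ℚ)) ((y - x) * (x * y - 1ℚ))) ⟩
    N₁ ÷ D₁ + N₂ ÷ D₂
      ≡⟨ p÷q+r÷s≡[p*s+r*q]÷[q*s] N₁ N₂ D₁≢0 D₂≢0 ⟩
    (N₁ * D₂ + N₂ * D₁) ÷ (D₁ * D₂)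
      ≡⟨ cong (_÷ (D₁ * D₂)) (cancel t x y) ⟩
    0ℚ * inv (D₁ * D₂)
      ≡⟨ *-zeroˡ (inv (D₁ * D₂)) ⟩
    0ℚ ∎
    where
    open ≡-Reasoning
    N₁ = (1ℚ - t * (y * y)) * (x * (t - y * y))
    D₁ = (1ℚ - y * y) * ((1ℚ - x * y) * (x - y))
    N₂ = (y * y - t) * (x * (t * (y * y) - 1ℚ))
    D₂ = (y * y - 1ℚ) * ((y - x) * (x * y - 1ℚ))
    D₁≢0 = *-≢0 (≢1⇒1-≢0 yy≢1) (*-≢0 (≢1⇒1-≢0 xy≢1) (≢⇒-≢0 x≢y))
    D₂≢0 = *-≢0 (≢⇒-≢0 yy≢1) (*-≢0 (≢⇒-≢0 (x≢y ∘′ sym)) (≢⇒-≢0 xy≢1))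
    cancel : ∀ t x y →
      (1ℚ - t * (y * y)) * (x * (t - y * y)) * ((y * y - 1ℚ) * ((y - x) * (x * y - 1ℚ)))
        + (y * y - t) * (x * (t * (y * y) - 1ℚ)) * ((1ℚ - y * y) * ((1ℚ - x * y) * (x - y)))
      ≡ 0ℚ
    cancel = solve-∀ ℚ-ring

  χ : ℚ → ℚ → ℚ
  χ y z = c (y * z) * c (y ÷ z)

  χ-inv : ∀ y z → χ y (inv z) ≡ χ y z
  χ-inv y z = trans (cong (λ e → c (y ÷ z) * c (y * e)) (inv-involutive z)) (*-comm (c (y ÷ z)) (c (y * z)))

module PartialFractions (t : ℚ) where
  open Factor t

  residue : ℚ → List ℚ → ℚ
  residue y r = prod (λ z → c (z ÷ y)) r

  ∏c-partial-fractions : ∀ w zs → All (_≢ 0ℚ) zs → AllPairs _≢_ zs → All (λ z → w * z ≢ 1ℚ) zs →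
    prod (λ z → c (w * z)) zs ≡ t ^ length zs + (1ℚ - t) * ∑picks (λ y r → residue y r ÷ (1ℚ - w * y)) zs
  ∏c-partial-fractions w [] [] [] [] = sym (trans (cong (1ℚ +_) (*-zeroʳ (1ℚ - t))) (+-identityʳ 1ℚ))
  ∏c-partial-fractions w (a ∷ as) (a≢0 ∷ as≢0) (a≢as ∷ as-distinct) (wa≢1 ∷ was≢1) = begin
    c (w * a) * prod (λ z → c (w * z)) as
      ≡⟨ cong (c (w * a) *_) (∏c-partial-fractions w as as≢0 as-distinct was≢1) ⟩
    c (w * a) * (tᵐ + s * ∑picks (pole w) as)
      ≡⟨ distrib (c (w * a)) tᵐ s (∑picks (pole w) as) ⟩
    c (w * a) * tᵐ + s * (c (w * a) * ∑picks (pole w) as)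
      ≡⟨ cong (λ e → c (w * a) * tᵐ + s * e) (∑picks-*ˡ (c (w * a)) as) ⟨
    c (w * a) * tᵐ + s * ∑picks (λ y r → c (w * a) * pole w y r) as
      ≡⟨ cong (λ e → c (w * a) * tᵐ + s * e) (∑picks-cong as absorb) ⟩
    c (w * a) * tᵐ + s * ∑picks (λ y r → pole w y (a ∷ r) + s * inv[1-wa] * pole (inv a) y r) as
      ≡⟨ cong (λ e → c (w * a) * tᵐ + s * e) (trans (∑picks-+ as) (cong (X +_) (∑picks-*ˡ (s * inv[1-wa]) as))) ⟩
    c (w * a) * tᵐ + s * (X + s * inv[1-wa] * Y)
      ≡⟨ cong (λ e → e * tᵐ + s * (X + s * inv[1-wa] * Y)) (c-partial-fraction wa≢1) ⟩
    (t + s * inv[1-wa]) * tᵐ + s * (X + s * inv[1-wa] * Y)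
      ≡⟨ regroup t tᵐ inv[1-wa] X Y ⟩
    t * tᵐ + s * ((tᵐ + s * Y) * inv[1-wa] + X)
      ≡⟨ cong (λ e → t * tᵐ + s * (e * inv[1-wa] + X)) residue-a ⟨
    t ^ suc (length as) + s * (residue a as ÷ (1ℚ - w * a) + X) ∎
    where
    open ≡-Reasoning
    tᵐ = t ^ length as
    s = 1ℚ - t
    inv[1-wa] = inv (1ℚ - w * a)
    pole : ℚ → ℚ → List ℚ → ℚ
    pole w′ y r = residue y r ÷ (1ℚ - w′ * y)
    X = ∑picks (λ y r → pole w y (a ∷ r)) as
    Y = ∑picks (pole (inv a)) as
    distrib : ∀ k T s P → k * (T + s * P) ≡ k * T + s * (k * P)
    distrib = solve-∀ ℚ-ring
    regroup : ∀ t T I X Y → (t + (1ℚ - t) * I) * T + (1ℚ - t) * (X + (1ℚ - t) * I * Y)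
                            ≡ t * T + (1ℚ - t) * ((T + (1ℚ - t) * Y) * I + X)
    regroup = solve-∀ ℚ-ring
    residue-a : residue a as ≡ tᵐ + s * Y
    residue-a = trans (prod-cong (λ z → cong c (*-comm z (inv a))) as)
                      (∏c-partial-fractions (inv a) as as≢0 as-distinct
                         (All.map (λ a≢z e → a≢z (sym (inv*≡1⇒≡ e))) a≢as))
    absorb : ∀ {y r} → Pick as y r → c (w * a) * pole w y r ≡ pole w y (a ∷ r) + s * inv[1-wa] * pole (inv a) y r
    absorb {y} {r} p = begin
      c (w * a) * (R * inv[1-wy])
        ≡⟨ cong (_* (R * inv[1-wy])) (c-partial-fraction wa≢1) ⟩
      (t + s * inv[1-wa]) * (R * inv[1-wy])
        ≡⟨ expand₁ t inv[1-wa] R inv[1-wy] ⟩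
      t * R * inv[1-wy] + s * R * (inv[1-wa] * inv[1-wy])
        ≡⟨ cong (λ e → t * R * inv[1-wy] + s * R * e)
                (partial-fractions-two-poles {w = w} a≢0 y≢0 a≢y wa≢1 wy≢1) ⟩
      t * R * inv[1-wy] + s * R * (inv[1-a÷y] * inv[1-wy] + inv[1-wa] * inv[1-y÷a])
        ≡⟨ expand₂ t inv[1-wa] R inv[1-wy] inv[1-a÷y] inv[1-y÷a] ⟩
      (t + s * inv[1-a÷y]) * R * inv[1-wy] + s * inv[1-wa] * (R * inv[1-y÷a])
        ≡⟨ cong (λ e → e * R * inv[1-wy] + s * inv[1-wa] * (R * inv[1-y÷a])) (c-partial-fraction a÷y≢1) ⟨
      c (a ÷ y) * R * inv[1-wy] + s * inv[1-wa] * (R * inv[1-y÷a]) ∎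
      where
      R = residue y r
      inv[1-wy] = inv (1ℚ - w * y)
      inv[1-a÷y] = inv (1ℚ - a ÷ y)
      inv[1-y÷a] = inv (1ℚ - inv a * y)
      y≢0 = All.head (All-pick p as≢0)
      a≢y = All.head (All-pick p a≢as)
      wy≢1 = All.head (All-pick p was≢1)
      a÷y≢1 : a ÷ y ≢ 1ℚ
      a÷y≢1 e = a≢y (inv*≡1⇒≡ (trans (*-comm (inv y) a) e))
      expand₁ : ∀ t I R J → (t + (1ℚ - t) * I) * (R * J) ≡ t * R * J + (1ℚ - t) * R * (I * J)
      expand₁ = solve-∀ ℚ-ring
      expand₂ : ∀ t I R J K L → t * R * J + (1ℚ - t) * R * (K * J + I * L)
                                ≡ (t + (1ℚ - t) * K) * R * J + (1ℚ - t) * I * (R * L)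
      expand₂ = solve-∀ ℚ-ring

-- The hypotheses of the theorem in multiplicative form, which is visibly stable under inversion.
Point : ℚ → Set
Point a = a ≢ 0ℚ × a * a ≢ 1ℚ

Apart : ℚ → ℚ → Set
Apart a z = a ≢ z × a * z ≢ 1ℚ

Admissible : List ℚ → Set
Admissible xs = All Point xs × AllPairs Apart xs

Point-inv : Point a → Point (inv a)
Point-inv {a} (a≢0 , aa≢1) = inv-≢0 a≢0 , aa≢1 ∘′ inv≡⇒*≡1 a≢0 ∘′ inv*≡1⇒≡

Apart-sym : Apart a z → Apart z a
Apart-sym {a} {z} (a≢z , az≢1) = a≢z ∘′ sym , az≢1 ∘′ trans (*-comm a z)

Apart-invˡ : Apart a z → Apart (inv a) z
Apart-invˡ {a} {z} (a≢z , az≢1) = ia≢z , a≢z ∘′ sym ∘′ inv*≡1⇒≡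
  where
  ia≢z : inv a ≢ z
  ia≢z with 0ℚ ≟ a
  ... | yes refl = a≢z
  ... | no 0≢a = az≢1 ∘′ inv≡⇒*≡1 (0≢a ∘′ sym)

Apart-invʳ : Apart a z → Apart a (inv z)
Apart-invʳ = Apart-sym ∘′ Apart-invˡ ∘′ Apart-sym

open Flips inv

Admissible-flip : ∀ {xs ys} → Flip xs ys → Admissible xs → Admissible ys
Admissible-flip f (points , apart) = All-flip Point-inv f points , AllPairs-flip Apart-invˡ Apart-invʳ f apart

Admissible-pick : ∀ {xs y r} → Pick xs y r → Admissible xs → Admissible (y ∷ r)
Admissible-pick p (points , apart) = All-pick p points , AllPairs-pick Apart-sym p apart

Admissible-doubled : ∀ {xs} → Admissible xs → AllPairs _≢_ (doubled xs)
Admissible-doubled {[]}    _ = []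
Admissible-doubled {a ∷ _} ((a≢0 , aa≢1) ∷ points , a-apart ∷ apart) =
  (a≢inv[a] ∷ All-doubled (All.map (λ p → proj₁ p , proj₁ (Apart-invʳ p)) a-apart))
  ∷ All-doubled (All.map (λ p → proj₁ (Apart-invˡ p) , proj₁ (Apart-invʳ (Apart-invˡ p))) a-apart)
  ∷ Admissible-doubled (points , apart)
  where
  a≢inv[a] : a ≢ inv a
  a≢inv[a] = aa≢1 ∘′ inv≡⇒*≡1 a≢0 ∘′ sym

module Macdonald (t : ℚ) where
  open Factor t
  open PartialFractions t

  Φ : List ℚ → ℚ
  Φ []       = 1ℚ
  Φ (a ∷ as) = b a * prod (λ z → c (a * z)) as * Φ as

  P : ℕ → ℚ
  P n = ∏[1‥ n ] (λ i → t ^ i + 1ℚ)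

  Φ-pick : ∀ {xs y r} → Pick xs y r → Φ xs ≡ Φ (y ∷ r)
  Φ-pick here = refl
  Φ-pick {a ∷ as} {y} {_ ∷ r} (there p) = begin
    b a * prod (λ z → c (a * z)) as * Φ as
      ≡⟨ cong₂ (λ e e′ → b a * e * e′) (prod-pick p) (Φ-pick p) ⟩
    b a * (c (a * y) * Πₐ) * (b y * Πᵧ * Φ r)
      ≡⟨ cong (λ e → b a * (c e * Πₐ) * (b y * Πᵧ * Φ r)) (*-comm a y) ⟩
    b a * (c (y * a) * Πₐ) * (b y * Πᵧ * Φ r)
      ≡⟨ swap (b a) (c (y * a)) Πₐ (b y) Πᵧ (Φ r) ⟩
    b y * (c (y * a) * Πᵧ) * (b a * Πₐ * Φ r) ∎
    where
    open ≡-Reasoning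
    Πₐ = prod (λ z → c (a * z)) r
    Πᵧ = prod (λ z → c (y * z)) r
    swap : ∀ ba cya Πa by Πy Φr → ba * (cya * Πa) * (by * Πy * Φr) ≡ by * (cya * Πy) * (ba * Πa * Φr)
    swap = solve-∀ ℚ-ring

  Φ∷*prod : ∀ y r (g : ℚ → ℚ) → Φ (y ∷ r) * prod g r ≡ b y * (prod (λ z → c (y * z) * g z) r * Φ r)
  Φ∷*prod y r g = begin
    b y * prod (λ z → c (y * z)) r * Φ r * prod g r
      ≡⟨ regroup (b y) (prod (λ z → c (y * z)) r) (Φ r) (prod g r) ⟩
    b y * (prod (λ z → c (y * z)) r * prod g r * Φ r)
      ≡⟨ cong (λ e → b y * (e * Φ r)) (prod-* r) ⟨
    b y * (prod (λ z → c (y * z) * g z) r * Φ r) ∎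
    where
    open ≡-Reasoning
    regroup : ∀ b P Φ G → b * P * Φ * G ≡ b * (P * G * Φ)
    regroup = solve-∀ ℚ-ring

  residual : ℚ → ℚ → List ℚ → ℚ
  residual x y r = Φ (y ∷ r) * residue y r * h x y

  residual-antisymmetric : ∀ {x y} → Point y → Apart x y → ∀ r → residual x y r + residual x (inv y) r ≡ 0ℚ
  residual-antisymmetric {x} {y} (y≢0 , yy≢1) (x≢y , xy≢1) r = begin
    Φ (y ∷ r) * residue y r * h x y + Φ (inv y ∷ r) * residue (inv y) r * h x (inv y)
      ≡⟨ cong₂ (λ e e′ → e * h x y + e′ * h x (inv y)) (Φ∷*prod y r _) (Φ∷*prod (inv y) r _) ⟩
    b y * (prod (λ z → c (y * z) * c (z ÷ y)) r * Φ r) * h x y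
      + b (inv y) * (prod (λ z → c (inv y * z) * c (z ÷ inv y)) r * Φ r) * h x (inv y)
      ≡⟨ cong₂ (λ e e′ → b y * (e * Φ r) * h x y + b (inv y) * (e′ * Φ r) * h x (inv y))
               (prod-cong (λ z → cong (λ e → c e * c (z ÷ y)) (*-comm y z)) r)
               (prod-cong (λ z → trans (cong (λ e → c e * c (z ÷ inv y)) (*-comm (inv y) z)) (χ-inv z y)) r) ⟩
    b y * (prod (λ z → χ z y) r * Φ r) * h x y + b (inv y) * (prod (λ z → χ z y) r * Φ r) * h x (inv y)
      ≡⟨ factor (b y) (b (inv y)) (prod (λ z → χ z y) r * Φ r) (h x y) (h x (inv y)) ⟩
    prod (λ z → χ z y) r * Φ r * (b y * h x y + b (inv y) * h x (inv y))
      ≡⟨ cong (prod (λ z → χ z y) r * Φ r *_) (b*h-antisymmetric y≢0 yy≢1 xy≢1 x≢y) ⟩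
    prod (λ z → χ z y) r * Φ r * 0ℚ
      ≡⟨ *-zeroʳ (prod (λ z → χ z y) r * Φ r) ⟩
    0ℚ ∎
    where
    open ≡-Reasoning
    factor : ∀ b b′ P h h′ → b * P * h + b′ * P * h′ ≡ P * (b * h + b′ * h′)
    factor = solve-∀ ℚ-ring

  Φ-flip-pair : ∀ {x} ys → Point x → All (Apart x) ys → Admissible ys →
    Φ (x ∷ ys) + Φ (inv x ∷ ys) ≡ (1ℚ + t ^ suc (length ys)) * Φ ys + (1ℚ - t) * ∑picks (residual x) ys
  Φ-flip-pair {x} ys (x≢0 , xx≢1) x-apart (points , apart) = begin
    b x * prod (λ z → c (x * z)) ys * Φ ys + b (inv x) * prod (λ z → c (inv x * z)) ys * Φ ys
      ≡⟨ cong₂ (λ e e′ → b x * e * Φ ys + b (inv x) * e′ * Φ ys)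
               (∏c-partial-fractions x ys nonzero distinct (All.map proj₂ x-apart))
               (∏c-partial-fractions (inv x) ys nonzero distinct (All.map (proj₂ ∘′ Apart-invˡ) x-apart)) ⟩
    b x * (tᵐ + s * S x) * Φ ys + b (inv x) * (tᵐ + s * S (inv x)) * Φ ys
      ≡⟨ expand (b x) (b (inv x)) tᵐ s (S x) (S (inv x)) (Φ ys) ⟩
    ((b x + b (inv x)) * tᵐ + s * (b x * S x + b (inv x) * S (inv x))) * Φ ys
      ≡⟨ cong₂ (λ e e′ → (e * tᵐ + s * e′) * Φ ys) (b+b∘inv x≢0 xx≢1) poles ⟩
    ((1ℚ + t) * tᵐ + s * (S₀ + Q)) * Φ ys
      ≡⟨ collect t tᵐ S₀ Q (Φ ys) ⟩
    (tᵐ + s * S₀ + t * tᵐ) * Φ ys + s * (Φ ys * Q)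
      ≡⟨ cong₂ (λ e e′ → (e + t * tᵐ) * Φ ys + s * e′) one ΦQ ⟩
    (1ℚ + t * tᵐ) * Φ ys + s * ∑picks (residual x) ys ∎
    where
    open ≡-Reasoning
    tᵐ = t ^ length ys
    s = 1ℚ - t
    S : ℚ → ℚ
    S w = ∑picks (λ y r → residue y r ÷ (1ℚ - w * y)) ys
    S₀ = ∑picks residue ys
    Q = ∑picks (λ y r → residue y r * h x y) ys
    nonzero = All.map proj₁ points
    distinct = AllPairs.map proj₁ apart
    expand : ∀ b b′ T s P P′ Φ → b * (T + s * P) * Φ + b′ * (T + s * P′) * Φ
                                 ≡ ((b + b′) * T + s * (b * P + b′ * P′)) * Φ
    expand = solve-∀ ℚ-ring
    collect : ∀ t T S Q Φ → ((1ℚ + t) * T + (1ℚ - t) * (S + Q)) * Φ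
                            ≡ (T + (1ℚ - t) * S + t * T) * Φ + (1ℚ - t) * (Φ * Q)
    collect = solve-∀ ℚ-ring
    split-poles : ∀ b b′ R B B′ → b * (R * B) + b′ * (R * B′) ≡ R * (b * B + b′ * B′)
    split-poles = solve-∀ ℚ-ring
    poles : b x * S x + b (inv x) * S (inv x) ≡ S₀ + Q
    poles = begin
      b x * S x + b (inv x) * S (inv x)
        ≡⟨ cong₂ _+_ (∑picks-*ˡ (b x) ys) (∑picks-*ˡ (b (inv x)) ys) ⟨
      ∑picks (λ y r → b x * (residue y r ÷ (1ℚ - x * y))) ys
        + ∑picks (λ y r → b (inv x) * (residue y r ÷ (1ℚ - inv x * y))) ys
        ≡⟨ ∑picks-+ ys ⟨
      ∑picks (λ y r → b x * (residue y r ÷ (1ℚ - x * y)) + b (inv x) * (residue y r ÷ (1ℚ - inv x * y))) ys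
        ≡⟨ ∑picks-cong ys pointwise ⟩
      ∑picks (λ y r → residue y r + residue y r * h x y) ys
        ≡⟨ ∑picks-+ ys ⟩
      S₀ + Q ∎
      where
      pointwise : ∀ {y r} → Pick ys y r →
        b x * (residue y r ÷ (1ℚ - x * y)) + b (inv x) * (residue y r ÷ (1ℚ - inv x * y))
        ≡ residue y r + residue y r * h x y
      pointwise {y} {r} p = begin
        b x * (R * inv (1ℚ - x * y)) + b (inv x) * (R * inv (1ℚ - inv x * y))
          ≡⟨ split-poles (b x) (b (inv x)) R (inv (1ℚ - x * y)) (inv (1ℚ - inv x * y)) ⟩
        R * (b x ÷ (1ℚ - x * y) + b (inv x) ÷ (1ℚ - inv x * y))
          ≡⟨ cong (R *_) (b-poles x≢0 xx≢1 xy≢1 x≢y) ⟩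
        R * (1ℚ + h x y)
          ≡⟨ *-distribˡ-+ R 1ℚ (h x y) ⟩
        R * 1ℚ + R * h x y
          ≡⟨ cong (_+ R * h x y) (*-identityʳ R) ⟩
        R + R * h x y ∎
        where
        R = residue y r
        x≢y = proj₁ (All.head (All-pick p x-apart))
        xy≢1 = proj₂ (All.head (All-pick p x-apart))
    one : tᵐ + s * S₀ ≡ 1ℚ
    one = begin
      tᵐ + s * S₀
        ≡⟨ cong (λ e → tᵐ + s * e) (∑picks-cong ys λ {y} {r} _ →
             trans (cong (λ e → residue y r ÷ (1ℚ - e)) (*-zeroˡ y)) (*-identityʳ (residue y r))) ⟨
      tᵐ + s * ∑picks (λ y r → residue y r ÷ (1ℚ - 0ℚ * y)) ys
        ≡⟨ ∏c-partial-fractions 0ℚ ys nonzero distinct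
             (All.universal (λ z e → 0≢1 (trans (sym (*-zeroˡ z)) e)) ys) ⟨
      prod (λ z → c (0ℚ * z)) ys
        ≡⟨ prod-≡1 (λ z → trans (cong c (*-zeroˡ z)) c-0) ys ⟩
      1ℚ ∎
      where
      0≢1 : 0ℚ ≢ 1ℚ
      0≢1 ()
    ΦQ : Φ ys * Q ≡ ∑picks (residual x) ys
    ΦQ = trans (sym (∑picks-*ˡ (Φ ys) ys))
               (∑picks-cong ys λ {y} {r} p → trans (cong (_* (residue y r * h x y)) (Φ-pick p))
                                                   (sym (*-assoc (Φ (y ∷ r)) (residue y r) (h x y))))

  ∑flips-Φ : ∀ xs → Admissible xs → ∑flips Φ xs ≡ P (length xs)
  ∑flips-Φ []       _ = refl
  ∑flips-Φ (x ∷ xs) (px ∷ points , x-apart ∷ apart) = begin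
    ∑flips (λ ys → Φ (x ∷ ys)) xs + ∑flips (λ ys → Φ (inv x ∷ ys)) xs
      ≡⟨ ∑flips-+ (λ ys → Φ (x ∷ ys)) (λ ys → Φ (inv x ∷ ys)) xs ⟨
    ∑flips (λ ys → Φ (x ∷ ys) + Φ (inv x ∷ ys)) xs
      ≡⟨ ∑flips-cong xs flip-pair ⟩
    ∑flips (λ ys → 1+tᵐ⁺¹ * Φ ys + s * ∑picks (residual x) ys) xs
      ≡⟨ ∑flips-+ (λ ys → 1+tᵐ⁺¹ * Φ ys) (λ ys → s * ∑picks (residual x) ys) xs ⟩
    ∑flips (λ ys → 1+tᵐ⁺¹ * Φ ys) xs + ∑flips (λ ys → s * ∑picks (residual x) ys) xs
      ≡⟨ cong₂ _+_ (∑flips-*ˡ 1+tᵐ⁺¹ Φ xs) (∑flips-*ˡ s (∑picks (residual x)) xs) ⟩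
    1+tᵐ⁺¹ * ∑flips Φ xs + s * ∑flips (∑picks (residual x)) xs
      ≡⟨ cong₂ (λ e e′ → 1+tᵐ⁺¹ * e + s * e′) (∑flips-Φ xs (points , apart)) cancellation ⟩
    1+tᵐ⁺¹ * P (length xs) + s * 0ℚ
      ≡⟨ finish (t ^ suc (length xs)) (P (length xs)) s ⟩
    P (length xs) * (t ^ suc (length xs) + 1ℚ) ∎
    where
    open ≡-Reasoning
    s = 1ℚ - t
    1+tᵐ⁺¹ = 1ℚ + t ^ suc (length xs)
    finish : ∀ T P s → (1ℚ + T) * P + s * 0ℚ ≡ P * (T + 1ℚ)
    finish = solve-∀ ℚ-ring
    flip-pair : ∀ {ys} → Flip xs ys →
                Φ (x ∷ ys) + Φ (inv x ∷ ys) ≡ 1+tᵐ⁺¹ * Φ ys + s * ∑picks (residual x) ys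
    flip-pair {ys} f =
      trans (Φ-flip-pair ys px (All-flip Apart-invʳ f x-apart) (Admissible-flip f (points , apart)))
            (cong (λ n → (1ℚ + t ^ suc n) * Φ ys + s * ∑picks (residual x) ys) (sym (Pointwise-length f)))
    cancellation : ∑flips (∑picks (residual x)) xs ≡ 0ℚ
    cancellation = trans (∑flips-∑picks (residual x) xs) (∑picks-≡0 xs λ {y} {r} p →
      ∑flips-≡0 r (residual-antisymmetric (All.head (All-pick p points)) (All.head (All-pick p x-apart))))

Avoids : ℚ → ℚ → Set
Avoids u a = u * a ≢ 1ℚ × a ≢ u

≢⇒*inv≢1 : ∀ {u a} → a ≢ u → u * inv a ≢ 1ℚ
≢⇒*inv≢1 {u} {a} a≢u = a≢u ∘′ sym ∘′ inv*≡1⇒≡ ∘′ trans (*-comm (inv a) u)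

Avoids-inv : ∀ {u a} → a ≢ 0ℚ → Avoids u a → Avoids u (inv a)
Avoids-inv {u} {a} a≢0 (ua≢1 , a≢u) = ≢⇒*inv≢1 a≢u , ua≢1 ∘′ trans (*-comm u a) ∘′ inv≡⇒*≡1 a≢0

module Symmetrisation (t u : ℚ) where
  open Factor t
  open PartialFractions t
  open Macdonald t

  κ : ℚ → ℚ
  κ y = b y ÷ (1ℚ - u ÷ y)

  G : List ℚ → ℚ
  G ys = Φ ys * prod (λ y → c (u ÷ y)) ys

  G-expansion : ∀ ys → Admissible ys → All (Avoids u) ys →
    G ys ≡ t ^ length ys * Φ ys + (1ℚ - t) * ∑picks (λ y r → κ y * (prod (χ y) r * Φ r)) ys
  G-expansion ys (points , apart) avoids = begin
    Φ ys * prod (λ y → c (u ÷ y)) ys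
      ≡⟨ cong (Φ ys *_) (prod-map inv ys) ⟨
    Φ ys * prod (λ z → c (u * z)) (map inv ys)
      ≡⟨ cong (Φ ys *_) (∏c-partial-fractions u (map inv ys) nonzero distinct u-avoided) ⟩
    Φ ys * (t ^ length (map inv ys) + s * ∑picks (λ y r → residue y r ÷ (1ℚ - u * y)) (map inv ys))
      ≡⟨ cong₂ (λ n e → Φ ys * (t ^ n + s * e)) (length-map inv ys) (∑picks-map inv ys) ⟩
    Φ ys * (t ^ length ys + s * ∑picks (λ y r → residue (inv y) (map inv r) ÷ (1ℚ - u ÷ y)) ys)
      ≡⟨ distrib (Φ ys) (t ^ length ys) s _ ⟩
    t ^ length ys * Φ ys + s * (Φ ys * ∑picks (λ y r → residue (inv y) (map inv r) ÷ (1ℚ - u ÷ y)) ys)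
      ≡⟨ cong (λ e → t ^ length ys * Φ ys + s * e) (trans (sym (∑picks-*ˡ (Φ ys) ys)) (∑picks-cong ys term)) ⟩
    t ^ length ys * Φ ys + s * ∑picks (λ y r → κ y * (prod (χ y) r * Φ r)) ys ∎
    where
    open ≡-Reasoning
    s = 1ℚ - t
    nonzero = Allₚ.map⁺ (All.map (inv-≢0 ∘′ proj₁) points)
    distinct = AllPairsₚ.map⁺ (AllPairs.map (λ (a≢z , _) → a≢z ∘′ inv-injective) apart)
    u-avoided = Allₚ.map⁺ (All.map (≢⇒*inv≢1 ∘′ proj₂) avoids)
    distrib : ∀ Φ T s S → Φ * (T + s * S) ≡ T * Φ + s * (Φ * S)
    distrib = solve-∀ ℚ-ring
    term : ∀ {y r} → Pick ys y r →
      Φ ys * (residue (inv y) (map inv r) ÷ (1ℚ - u ÷ y)) ≡ κ y * (prod (χ y) r * Φ r)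
    term {y} {r} p = begin
      Φ ys * (residue (inv y) (map inv r) * inv (1ℚ - u ÷ y))
        ≡⟨ cong₂ (λ e e′ → e * (e′ * inv (1ℚ - u ÷ y))) (Φ-pick p) (prod-map inv r) ⟩
      Φ (y ∷ r) * (prod (λ z → c (inv z ÷ inv y)) r * inv (1ℚ - u ÷ y))
        ≡⟨ cong (λ e → Φ (y ∷ r) * (e * inv (1ℚ - u ÷ y))) (prod-cong inv-quotient r) ⟩
      Φ (y ∷ r) * (prod (λ z → c (y ÷ z)) r * inv (1ℚ - u ÷ y))
        ≡⟨ sym (*-assoc (Φ (y ∷ r)) _ (inv (1ℚ - u ÷ y))) ⟩
      Φ (y ∷ r) * prod (λ z → c (y ÷ z)) r * inv (1ℚ - u ÷ y)
        ≡⟨ cong (_* inv (1ℚ - u ÷ y)) (Φ∷*prod y r (λ z → c (y ÷ z))) ⟩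
      b y * (prod (χ y) r * Φ r) * inv (1ℚ - u ÷ y)
        ≡⟨ reorder (b y) (prod (χ y) r * Φ r) (inv (1ℚ - u ÷ y)) ⟩
      κ y * (prod (χ y) r * Φ r) ∎
      where
      inv-quotient : ∀ z → c (inv z ÷ inv y) ≡ c (y ÷ z)
      inv-quotient z = cong c (trans (cong (inv z *_) (inv-involutive y)) (*-comm (inv z) y))
      reorder : ∀ b X i → b * X * i ≡ b * i * X
      reorder = solve-∀ ℚ-ring

  pairedResidue : ℚ → List ℚ → ℚ
  pairedResidue y r = κ y * prod (χ y) r + κ (inv y) * prod (χ (inv y)) r

  ∑flips-G : ∀ xs → Admissible xs → All (Avoids u) xs →
    ∑flips G xs ≡ t ^ length xs * P (length xs) + (1ℚ - t) * ∑picks (λ y r → pairedResidue y r * P (length r)) xs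
  ∑flips-G xs adm@(points , apart) avoids = begin
    ∑flips G xs
      ≡⟨ ∑flips-cong xs expansion ⟩
    ∑flips (λ ys → tⁿ * Φ ys + s * ∑picks M ys) xs
      ≡⟨ ∑flips-+ (λ ys → tⁿ * Φ ys) (λ ys → s * ∑picks M ys) xs ⟩
    ∑flips (λ ys → tⁿ * Φ ys) xs + ∑flips (λ ys → s * ∑picks M ys) xs
      ≡⟨ cong₂ _+_ (∑flips-*ˡ tⁿ Φ xs) (∑flips-*ˡ s (∑picks M) xs) ⟩
    tⁿ * ∑flips Φ xs + s * ∑flips (∑picks M) xs
      ≡⟨ cong₂ (λ e e′ → tⁿ * e + s * e′) (∑flips-Φ xs adm) (∑flips-∑picks M xs) ⟩
    tⁿ * P (length xs) + s * ∑picks (λ y r → ∑flips (λ rs → M y rs + M (inv y) rs) r) xs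
      ≡⟨ cong (λ e → tⁿ * P (length xs) + s * e) (∑picks-cong xs pair-sum) ⟩
    tⁿ * P (length xs) + s * ∑picks (λ y r → pairedResidue y r * P (length r)) xs ∎
    where
    open ≡-Reasoning
    tⁿ = t ^ length xs
    s = 1ℚ - t
    M : ℚ → List ℚ → ℚ
    M y rs = κ y * (prod (χ y) rs * Φ rs)
    expansion : ∀ {ys} → Flip xs ys → G ys ≡ tⁿ * Φ ys + s * ∑picks M ys
    expansion {ys} f =
      trans (G-expansion ys (Admissible-flip f adm) (All.map proj₂ (All-flip invariant f (All.zip (points , avoids)))))
            (cong (λ n → t ^ n * Φ ys + s * ∑picks M ys) (sym (Pointwise-length f)))
      where
      invariant : ∀ {a} → Point a × Avoids u a → Point (inv a) × Avoids u (inv a)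
      invariant (pa , aa) = Point-inv pa , Avoids-inv (proj₁ pa) aa
    pair-sum : ∀ {y r} → Pick xs y r → ∑flips (λ rs → M y rs + M (inv y) rs) r ≡ pairedResidue y r * P (length r)
    pair-sum {y} {r} p = begin
      ∑flips (λ rs → M y rs + M (inv y) rs) r
        ≡⟨ ∑flips-+ (M y) (M (inv y)) r ⟩
      ∑flips (M y) r + ∑flips (M (inv y)) r
        ≡⟨ cong₂ _+_ (∑flips-*ˡ (κ y) _ r) (∑flips-*ˡ (κ (inv y)) _ r) ⟩
      κ y * ∑flips (λ rs → prod (χ y) rs * Φ rs) r + κ (inv y) * ∑flips (λ rs → prod (χ (inv y)) rs * Φ rs) r
        ≡⟨ cong₂ (λ e e′ → κ y * e + κ (inv y) * e′)
                 (∑flips-prod (χ-inv y) Φ r) (∑flips-prod (χ-inv (inv y)) Φ r) ⟩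
      κ y * (prod (χ y) r * ∑flips Φ r) + κ (inv y) * (prod (χ (inv y)) r * ∑flips Φ r)
        ≡⟨ cong (λ e → κ y * (prod (χ y) r * e) + κ (inv y) * (prod (χ (inv y)) r * e)) (∑flips-Φ r adm-r) ⟩
      κ y * (prod (χ y) r * P (length r)) + κ (inv y) * (prod (χ (inv y)) r * P (length r))
        ≡⟨ factor (κ y) (prod (χ y) r) (κ (inv y)) (prod (χ (inv y)) r) (P (length r)) ⟩
      pairedResidue y r * P (length r) ∎
      where
      adm-r : Admissible r
      adm-r with Admissible-pick p adm
      ... | _ ∷ points-r , _ ∷ apart-r = points-r , apart-r
      factor : ∀ k X k′ X′ Q → k * (X * Q) + k′ * (X′ * Q) ≡ (k * X + k′ * X′) * Q
      factor = solve-∀ ℚ-ring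

  ∏c-doubled : ∀ xs → Admissible xs → All (Avoids u) xs →
    prod (λ x → c (u * x) * c (u ÷ x)) xs ≡ t ^ (length xs ℕ.+ length xs) + (1ℚ - t) * ∑picks pairedResidue xs
  ∏c-doubled xs (points , apart) avoids = begin
    prod (λ x → c (u * x) * c (u ÷ x)) xs
      ≡⟨ prod-doubled xs ⟨
    prod (λ z → c (u * z)) (doubled xs)
      ≡⟨ ∏c-partial-fractions u (doubled xs) nonzero distinct u-avoided ⟩
    t ^ length (doubled xs) + (1ℚ - t) * ∑picks (λ y r → residue y r ÷ (1ℚ - u * y)) (doubled xs)
      ≡⟨ cong₂ (λ n e → t ^ n + (1ℚ - t) * e) (length-doubled xs) regroup ⟩
    t ^ (length xs ℕ.+ length xs) + (1ℚ - t) * ∑picks pairedResidue xs ∎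
    where
    open ≡-Reasoning
    ψ : ℚ → ℚ → ℚ
    ψ y z = c (z ÷ y)
    E : ℚ → ℚ
    E y = inv (1ℚ - u * y)
    regroup : ∑picks (λ y r → residue y r ÷ (1ℚ - u * y)) (doubled xs) ≡ ∑picks pairedResidue xs
    regroup = begin
      ∑picks (λ y r → prod (ψ y) r * E y) (doubled xs)
        ≡⟨ ∑picks-cong (doubled xs) (λ {y} {r} _ → *-comm (prod (ψ y) r) (E y)) ⟩
      ∑picks (λ y r → E y * prod (ψ y) r) (doubled xs)
        ≡⟨ ∑picks-doubled ψ E xs ⟩
      ∑picks (λ y r → E y * ψ y (inv y) * prod (λ z → ψ y z * ψ y (inv z)) r
                    + E (inv y) * ψ (inv y) y * prod (λ z → ψ (inv y) z * ψ (inv y) (inv z)) r) xs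
        ≡⟨ ∑picks-cong xs (λ {y} {r} _ → trans (cong₂ _+_ (term-inv y r) (term y r))
                                                (+-comm (κ (inv y) * prod (χ (inv y)) r) (κ y * prod (χ y) r))) ⟩
      ∑picks pairedResidue xs ∎
      where
      term : ∀ y r → E (inv y) * ψ (inv y) y * prod (λ z → ψ (inv y) z * ψ (inv y) (inv z)) r ≡ κ y * prod (χ y) r
      term y r = cong₂ _*_
        (trans (*-comm (E (inv y)) _) (cong (λ e → c (y * e) * E (inv y)) (inv-involutive y)))
        (prod-cong (λ z → trans (cong (λ e → c (z * e) * c (inv z * e)) (inv-involutive y))
                                (cong₂ (λ e e′ → c e * c e′) (*-comm z y) (*-comm (inv z) y))) r)
      term-inv : ∀ y r → E y * ψ y (inv y) * prod (λ z → ψ y z * ψ y (inv z)) r ≡ κ (inv y) * prod (χ (inv y)) r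
      term-inv y r = cong₂ _*_
        (trans (*-comm (E y) _) (cong (λ e → b (inv y) * inv (1ℚ - u * e)) (sym (inv-involutive y))))
        (prod-cong (λ z → cong₂ (λ e e′ → c e * c e′) (*-comm z (inv y)) (*-comm (inv z) (inv y))) r)
    nonzero = All-doubled (All.map (λ (z≢0 , _) → z≢0 , inv-≢0 z≢0) points)
    distinct = Admissible-doubled (points , apart)
    u-avoided = All-doubled (All.map (λ (uz≢1 , z≢u) → uz≢1 , ≢⇒*inv≢1 z≢u) avoids)

  ∑flips-G-closed-form : ∀ a as → Admissible (a ∷ as) → All (Avoids u) (a ∷ as) →
    ∑flips G (a ∷ as) ≡ P (length as) * (t ^ suc (length as) + prod (λ x → c (u * x) * c (u ÷ x)) (a ∷ as))
  ∑flips-G-closed-form a as adm avoids = begin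
    ∑flips G (a ∷ as)
      ≡⟨ ∑flips-G (a ∷ as) adm avoids ⟩
    tⁿ * (P m * (tⁿ + 1ℚ)) + s * ∑picks (λ y r → pairedResidue y r * P (length r)) (a ∷ as)
      ≡⟨ cong (λ e → tⁿ * (P m * (tⁿ + 1ℚ)) + s * e)
              (trans (∑picks-cong (a ∷ as) P[length]) (∑picks-*ˡ {K = pairedResidue} (P m) (a ∷ as))) ⟩
    tⁿ * (P m * (tⁿ + 1ℚ)) + s * (P m * S)
      ≡⟨ collect tⁿ (P m) s S ⟩
    P m * (tⁿ + (tⁿ * tⁿ + s * S))
      ≡⟨ cong (λ e → P m * (tⁿ + (e + s * S))) (^-distribˡ-+-* t (suc m) (suc m)) ⟨
    P m * (tⁿ + (t ^ (suc m ℕ.+ suc m) + s * S))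
      ≡⟨ cong (λ e → P m * (tⁿ + e)) (∏c-doubled (a ∷ as) adm avoids) ⟨
    P m * (tⁿ + prod (λ x → c (u * x) * c (u ÷ x)) (a ∷ as)) ∎
    where
    open ≡-Reasoning
    m = length as
    tⁿ = t ^ suc m
    s = 1ℚ - t
    S = ∑picks pairedResidue (a ∷ as)
    P[length] : ∀ {y r} → Pick (a ∷ as) y r → pairedResidue y r * P (length r) ≡ P m * pairedResidue y r
    P[length] {y} {r} p = trans (cong (λ n → pairedResidue y r * P n) (ℕ.suc-injective (sym (Pick-length p))))
                                (*-comm (pairedResidue y r) (P m))
    collect : ∀ T Pm s S → T * (Pm * (T + 1ℚ)) + s * (Pm * S) ≡ Pm * (T + (T * T + s * S))
    collect = solve-∀ ℚ-ring

∏-cong : ∀ {n} {f g : Fin n → ℚ} → (∀ i → f i ≡ g i) → ∏ f ≡ ∏ g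
∏-cong {zero}  f≗g = refl
∏-cong {suc n} f≗g = cong₂ _*_ (f≗g zero) (∏-cong (f≗g ∘ suc))

∏-toList : ∀ {n} (f : ℚ → ℚ) (x : Vector ℚ n) → ∏ (f ∘ x) ≡ prod f (toList x)
∏-toList {zero}  f x = refl
∏-toList {suc n} f x = cong (f (x zero) *_) (∏-toList f (tail x))

-- ∏< decides i < j inside a local where-function, which cannot be named here: the statement of
-- ∏<-entry is left to unification, and its two sides are compared by abstracting both decisions.
mutual
  ∏<-suc : ∀ {n} (f : Fin (suc n) → Fin (suc n) → ℚ) →
           ∏< f ≡ (1ℚ * ∏ (λ j → f zero (suc j))) * ∏< (λ i j → f (suc i) (suc j))
  ∏<-suc {n} f = cong ((1ℚ * ∏ (λ j → f zero (suc j))) *_)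
                      (∏-cong {n} λ i → trans (*-identityˡ _) (∏-cong {n} λ j → ∏<-entry f i j))

  ∏<-entry : ∀ {n} (f : Fin (suc n) → Fin (suc n) → ℚ) (i j : Fin n) → _ ≡ _
  ∏<-entry f i j with suc i <? suc j | i <? j
  ... | yes _           | yes _   = refl
  ... | no _            | no _    = refl
  ... | yes (ℕ.s≤s i<j) | no i≮j  = contradiction i<j i≮j
  ... | no si≮sj        | yes i<j = contradiction (ℕ.s≤s i<j) si≮sj

symOpOn : ∀ {n} → List (Fin n) → Fun n → Fun n
symOpOn is = List.foldr (λ i op → 1+T i ∘ op) id is

symOpOn-cong : ∀ {n} (is : List (Fin n)) {f g : Fun n} → (∀ y → f y ≡ g y) →
               ∀ x → symOpOn is f x ≡ symOpOn is g x
symOpOn-cong []       f≗g x = f≗g x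
symOpOn-cong (i ∷ is) f≗g x = cong₂ _+_ (symOpOn-cong is f≗g x) (symOpOn-cong is f≗g (updateAt x i inv))

symOpOn-suc : ∀ {n k} (g : Fin k → Fin n) (G : List ℚ → ℚ) (x : Vector ℚ (suc n)) →
  symOpOn (List.tabulate (suc ∘ g)) (G ∘ toList) x ≡ symOpOn (List.tabulate g) (λ y → G (x zero ∷ toList y)) (tail x)
symOpOn-suc {k = zero}  g G x = refl
symOpOn-suc {k = suc k} g G x =
  cong₂ _+_ (symOpOn-suc (g ∘ suc) G x) (symOpOn-suc (g ∘ suc) G (updateAt x (suc (g zero)) inv))

symOp≡∑flips : ∀ {n} (G : List ℚ → ℚ) (x : Vector ℚ n) → symOp (G ∘ toList) x ≡ ∑flips G (toList x)
symOp≡∑flips {zero}  G x = refl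
symOp≡∑flips {suc n} G x =
  cong₂ _+_ (trans (symOpOn-suc id G x) (symOp≡∑flips (λ ys → G (x zero ∷ ys)) (tail x)))
            (trans (symOpOn-suc id G (updateAt x zero inv)) (symOp≡∑flips (λ ys → G (inv (x zero) ∷ ys)) (tail x)))

module Translation (t u : ℚ) where
  open Factor t
  open Macdonald t
  open Symmetrisation t u

  Φ-toList : ∀ {n} (x : Vector ℚ n) → prod b (toList x) * ∏< (λ i j → c (x i * x j)) ≡ Φ (toList x)
  Φ-toList {zero}  x = refl
  Φ-toList {suc n} x = begin
    b (x zero) * prod b (toList (tail x)) * ∏< (λ i j → c (x i * x j))
      ≡⟨ cong (b (x zero) * prod b (toList (tail x)) *_) (∏<-suc (λ i j → c (x i * x j))) ⟩
    b (x zero) * prod b (toList (tail x)) * (1ℚ * ∏ (λ j → c (x zero * x (suc j))) * pairs)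
      ≡⟨ regroup (b (x zero)) (prod b (toList (tail x))) (∏ (λ j → c (x zero * x (suc j)))) pairs ⟩
    b (x zero) * ∏ (λ j → c (x zero * x (suc j))) * (prod b (toList (tail x)) * pairs)
      ≡⟨ cong₂ (λ e e′ → b (x zero) * e * e′) (∏-toList (λ z → c (x zero * z)) (tail x)) (Φ-toList (tail x)) ⟩
    b (x zero) * prod (λ z → c (x zero * z)) (toList (tail x)) * Φ (toList (tail x)) ∎
    where
    open ≡-Reasoning
    pairs = ∏< (λ i j → c (x (suc i) * x (suc j)))
    regroup : ∀ b P Π Q → b * P * (1ℚ * Π * Q) ≡ b * Π * (P * Q)
    regroup = solve-∀ ℚ-ring

  F≡G∘toList : ∀ {n} (x : Vector ℚ n) → F t u x ≡ G (toList x)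
  F≡G∘toList x = begin
    ∏ (λ i → b (x i) * cu (x i)) * ∏< (λ i j → c (x i * x j))
      ≡⟨ cong (_* ∏< (λ i j → c (x i * x j))) (trans (∏-toList (λ z → b z * cu z) x) (prod-* (toList x))) ⟩
    prod b (toList x) * prod cu (toList x) * ∏< (λ i j → c (x i * x j))
      ≡⟨ swap (prod b (toList x)) (prod cu (toList x)) (∏< (λ i j → c (x i * x j))) ⟩
    prod b (toList x) * ∏< (λ i j → c (x i * x j)) * prod cu (toList x)
      ≡⟨ cong₂ _*_ (Φ-toList x) (prod-cong cu≡c[u÷z] (toList x)) ⟩
    Φ (toList x) * prod (λ z → c (u ÷ z)) (toList x) ∎
    where
    open ≡-Reasoning
    cu : ℚ → ℚ
    cu z = (1ℚ - t * u ÷ z) ÷ (1ℚ - u ÷ z)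
    cu≡c[u÷z] : ∀ z → cu z ≡ c (u ÷ z)
    cu≡c[u÷z] z = cong (λ e → (1ℚ - e) ÷ (1ℚ - u ÷ z)) (*-assoc t u (inv z))
    swap : ∀ p q r → p * q * r ≡ p * r * q
    swap = solve-∀ ℚ-ring

  RHS-toList : ∀ m (x : Vector ℚ (suc m)) →
               RHS t u x ≡ P m * (t ^ suc m + prod (λ z → c (u * z) * c (u ÷ z)) (toList x))
  RHS-toList m x =
    cong (λ e → P m * (t ^ suc m + e)) (trans (∏-toList (λ z → cU z * cu z) x) (prod-cong cU*cu≡ (toList x)))
    where
    cU cu : ℚ → ℚ
    cU z = (1ℚ - t * u * z) ÷ (1ℚ - u * z)
    cu z = (1ℚ - t * u ÷ z) ÷ (1ℚ - u ÷ z)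
    cU*cu≡ : ∀ z → cU z * cu z ≡ c (u * z) * c (u ÷ z)
    cU*cu≡ z = cong₂ (λ e e′ → (1ℚ - e) ÷ (1ℚ - u * z) * ((1ℚ - e′) ÷ (1ℚ - u ÷ z)))
                     (*-assoc t u z) (*-assoc t u (inv z))

theorem5 : (n : ℕ) → .{{_ : NonZero n}} → (t u : ℚ) → (x : Fin n → ℚ)
    → (∀ i → x i ≢ 0ℚ)
    → (∀ i → 1ℚ - x i * x i ≢ 0ℚ)
    → (∀ i → 1ℚ - u * x i ≢ 0ℚ)
    → (∀ i → x i - u ≢ 0ℚ)
    → (∀ i j → i ≢ j → 1ℚ - x i * x j ≢ 0ℚ)
    → (∀ i j → i ≢ j → x i - x j ≢ 0ℚ)
    → symOp (F t u) x ≡ RHS t u x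
theorem5 (suc m) t u x x≢0 1-xx≢0 1-ux≢0 x-u≢0 1-xx′≢0 x-x′≢0 = begin
  symOp (F t u) x                  ≡⟨ symOpOn-cong (List.allFin (suc m)) F≡G∘toList x ⟩
  symOp (G ∘ toList) x             ≡⟨ symOp≡∑flips G x ⟩
  ∑flips G (toList x)              ≡⟨ ∑flips-G-closed-form (x zero) (toList (tail x)) admissible avoids ⟩
  P m′ * (t ^ suc m′ + ∏cc)        ≡⟨ cong (λ k → P k * (t ^ suc k + ∏cc)) (length-tabulate (tail x)) ⟩
  P m * (t ^ suc m + ∏cc)          ≡⟨ RHS-toList m x ⟨
  RHS t u x                        ∎
  where
  open ≡-Reasoning
  open Factor t
  open Macdonald t
  open Symmetrisation t u
  open Translation t u
  m′ = length (toList (tail x))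
  ∏cc = prod (λ z → c (u * z) * c (u ÷ z)) (toList x)
  admissible : Admissible (toList x)
  admissible = Allₚ.tabulate⁺ {f = x} (λ i → x≢0 i , 1-≢0⇒≢1 (1-xx≢0 i))
             , AllPairsₚ.tabulate⁺ {f = x} (λ {i} {j} i≢j →
                 -≢0⇒≢ (x-x′≢0 i j i≢j) , 1-≢0⇒≢1 (1-xx′≢0 i j i≢j))
  avoids : All (Avoids u) (toList x)
  avoids = Allₚ.tabulate⁺ {f = x} (λ i → 1-≢0⇒≢1 (1-ux≢0 i) , -≢0⇒≢ (x-u≢0 i))
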